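{- If $T$ is a tree, then $\operatorname{svs}(T)=0$ if $T$ is the trivial (one-vertex) graph, $\operatorname{svs}(T)=1$ if $T$ is a non-trivial path, and $\operatorname{svs}(T)=\mathfrak{H}(T)$ otherwise.
   Context: A weak homomorphism $f:G\to H$ is a map $f:V(G)\to V(H)$ such that for every edge $uv\in E(G)$, either $f(u)f(v)\in E(H)$ or $f(u)=f(v)$; it is surjective if $f(V(G))=V(H)$. For weak homomorphisms $f,g:G\to H$, $m_G(f,g)=\min\{d_H(f(u),g(u))\mid u\in V(G)\}$. For a connected graph $H$, the strong vertex span is $\operatorname{svs}(H)=\max\{m_P(f,g)\mid P \text{ is a path and } f,g:P\to H \text{ are surjective weak homomorphisms}\}$. For a vertex $v$ of a tree $T$, the components of $T-\{v\}$ are its maximal connected subgraphs; for such a component $C(v)$, $\operatorname{reach}(C(v))=\max\{d(v,u)\mid u\in V(C(v))\cup\{v\}\}$. Denote the components of $T-\{v\}$ by $C_1(v),\dots,C_{\deg(v)}(v)$ with $\operatorname{reach}(C_i(v))\ge\operatorname{reach}(C_{i+1}(v))$. The triod size of $v$ is $\eta(v)=\operatorname{reach}(C_3(v))$ if $\deg(v)\ge 3$ and $\eta(v)=0$ if $\deg(v)\le 2$; the triod size of $T$ is $\mathfrak{H}(T)=\max\{\eta(v)\mid v\in V(T)\}$. -}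

module Defs where

open import Data.Nat using (ℕ; zero; suc; _≤_; _<_)
open import Data.Fin using (Fin; toℕ; fromℕ; fromℕ<; inject₁) renaming (zero to fzero; suc to fsuc)
open import Data.List using (List; length; filter; allFin)
open import Data.Product using (Σ; ∃; _×_; _,_)
open import Data.Sum using (_⊎_)
open import Data.Unit using (⊤)
open import Relation.Nullary using (¬_; Dec)
open import Relation.Binary.PropositionalEquality using (_≡_; _≢_)
open import Function.Bundles using (_⇔_)

record Graph : Set₁ where
  field
    n     : ℕ
    _~_   : Fin n → Fin n → Set
    ~-sym : ∀ {u v} → u ~ v → v ~ u
    ~-irr : ∀ {u} → ¬ (u ~ u)
    ~-dec : ∀ u v → Dec (u ~ v)

open Graph public

V : Graph → Set
V G = Fin (n G)

Adj : (G : Graph) → V G → V G → Set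
Adj G = _~_ G

data WalkIn (G : Graph) (P : V G → Set) : V G → V G → ℕ → Set where
  stop : ∀ {u} → P u → WalkIn G P u u 0
  step : ∀ {u w v k} → P u → Adj G u w → WalkIn G P w v k → WalkIn G P u v (suc k)

Walk : (G : Graph) → V G → V G → ℕ → Set
Walk G = WalkIn G (λ _ → ⊤)

Dist : (G : Graph) → V G → V G → ℕ → Set
Dist G u v k = Walk G u v k × (∀ j → Walk G u v j → k ≤ j)

Connected : Graph → Set
Connected G = ∀ u v → ∃ λ k → Walk G u v k

HasCycle : Graph → Set
HasCycle G = Σ ℕ λ m → Σ (Fin (suc (suc (suc m))) → V G) λ c →
  (∀ i j → c i ≡ c j → i ≡ j) ×
  (∀ (i : Fin (suc (suc m))) → Adj G (c (inject₁ i)) (c (fsuc i))) ×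
  Adj G (c (fromℕ (suc (suc m)))) (c fzero)

IsTree : Graph → Set
IsTree G = (1 ≤ n G) × Connected G × ¬ HasCycle G

pathAdj : ∀ {m} → Fin m → Fin m → Set
pathAdj i j = (toℕ j ≡ suc (toℕ i)) ⊎ (toℕ i ≡ suc (toℕ j))

PathGraph : ℕ → Graph
PathGraph m = record
  { n = m ; _~_ = pathAdj ; ~-sym = sym' ; ~-irr = irr ; ~-dec = dec }
  where
  open import Data.Sum using (inj₁; inj₂)
  open import Data.Nat.Properties using (_≟_)
  open import Data.Nat using (pred)
  open import Relation.Binary.PropositionalEquality using (cong)
  n≢1+n : ∀ k → k ≢ suc k
  n≢1+n zero ()
  n≢1+n (suc k) e = n≢1+n k (cong pred e)
  open import Relation.Nullary using (yes; no)
  open import Relation.Binary.PropositionalEquality using (sym)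
  sym' : ∀ {u v : Fin m} → pathAdj u v → pathAdj v u
  sym' (inj₁ p) = inj₂ p
  sym' (inj₂ p) = inj₁ p
  irr : ∀ {u : Fin m} → ¬ pathAdj u u
  irr {u} (inj₁ p) = n≢1+n (toℕ u) p
  irr {u} (inj₂ p) = n≢1+n (toℕ u) p
  dec : ∀ (u v : Fin m) → Dec (pathAdj u v)
  dec u v with toℕ v ≟ suc (toℕ u) | toℕ u ≟ suc (toℕ v)
  ... | yes p | _ = yes (inj₁ p)
  ... | no _ | yes q = yes (inj₂ q)
  ... | no ¬p | no ¬q = no λ { (inj₁ p) → ¬p p ; (inj₂ q) → ¬q q }

Isomorphic : Graph → Graph → Set
Isomorphic G H = Σ (V G → V H) λ σ →
  (∀ x y → σ x ≡ σ y → x ≡ y) × (∀ y → ∃ λ x → σ x ≡ y) ×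
  (∀ u v → Adj G u v ⇔ Adj H (σ u) (σ v))

IsPathGraph : Graph → Set
IsPathGraph G = ∃ λ m → Isomorphic (PathGraph m) G

WeakHom : (G H : Graph) → (V G → V H) → Set
WeakHom G H f = ∀ u v → Adj G u v → Adj H (f u) (f v) ⊎ f u ≡ f v

Surj : ∀ {A B : Set} → (A → B) → Set
Surj {A} {B} f = ∀ y → ∃ λ x → f x ≡ y

MinDist : (G H : Graph) → (f g : V G → V H) → ℕ → Set
MinDist G H f g k =
  (∃ λ u → Dist H (f u) (g u) k) ×
  (∀ u j → Dist H (f u) (g u) j → k ≤ j)

SurjPair : (H : Graph) (m : ℕ) → (f g : V (PathGraph (suc m)) → V H) → Set
SurjPair H m f g = WeakHom (PathGraph (suc m)) H f × WeakHom (PathGraph (suc m)) H g × Surj f × Surj g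

IsSVS : Graph → ℕ → Set
IsSVS H s =
  (Σ ℕ λ m → Σ (Fin (suc m) → V H) λ f → Σ (Fin (suc m) → V H) λ g →
     SurjPair H m f g × MinDist (PathGraph (suc m)) H f g s) ×
  (∀ m (f g : Fin (suc m) → V H) → SurjPair H m f g →
     ∀ k → MinDist (PathGraph (suc m)) H f g k → k ≤ s)

deg : (G : Graph) → V G → ℕ
deg G v = length (filter (~-dec G v) (allFin (n G)))

SameComp : (G : Graph) → V G → V G → V G → Set
SameComp G v u w = ∃ λ k → WalkIn G (λ x → x ≢ v) u w k

-- reach(C(v)) = r where C(v) is the component of G - {v} containing u
Reach : (G : Graph) → V G → V G → ℕ → Set
Reach G v u r =
  (∃ λ w → (SameComp G v u w ⊎ w ≡ v) × Dist G v w r) ×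
  (∀ w j → (SameComp G v u w ⊎ w ≡ v) → Dist G v w j → j ≤ r)

TriodAt : (G : Graph) → V G → ℕ → Set
TriodAt G v e =
  (deg G v ≤ 2 × e ≡ 0) ⊎
  (Σ (2 < deg G v) λ p →
   Σ (Fin (deg G v) → V G) λ c → Σ (Fin (deg G v) → ℕ) λ r →
     -- C_i(v) is the component containing c i; these enumerate all
     -- components of G - {v} without repetition
     (∀ i → c i ≢ v) ×
     (∀ i j → SameComp G v (c i) (c j) → i ≡ j) ×
     (∀ u → u ≢ v → ∃ λ i → SameComp G v (c i) u) ×
     (∀ i → Reach G v (c i) (r i)) ×
     (∀ i j → toℕ i ≤ toℕ j → r j ≤ r i) ×
     e ≡ r (fromℕ< p))

TriodSize : Graph → ℕ → Set
TriodSize G h = (∃ λ v → TriodAt G v h) × (∀ v e → TriodAt G v e → e ≤ h)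

-- Write next v w for the neighbour of v on the way to w; it names the component of T - v containing w.
--
-- If η(v₀) = H > 0, choose three vertices w₁ w₂ w₃ at distance ≥ H from v₀ in three
-- different components of T - v₀. Every vertex outside the component of wᵢ is at distance ≥ H from wᵢ,
-- because its geodesic to wᵢ passes through v₀. So one walker can wait on a leg while the other tours
-- everything outside that leg's component, and alternating the legs makes both walkers surjective.
-- On a path, two walkers trailing each other at distance one realise the value 1.
--
-- Fix a diametral pair a, b and let β w be twice the distance from a to the vertex where
-- w is attached to the spine from a to b. Suppose no vertex has a triod of size D ≥ 2. Then two walkers
-- kept at distance ≥ D can never change which of them has the smaller β: that could only happen with
-- one walker on a spine vertex s and the other at distance ≥ D hanging off s, and then a, b and that
-- walker form a triod of size D at s. But the first walker visits a (β = 0) and b (β maximal), so some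
-- distance is < D. With D = 𝔥(T) + 1 (or D = 2 on a path) this gives the matching upper bound. If
-- 𝔥(T) = 0, every vertex is on the spine, so T is a path.

module Submission where

open import Defs
open import Data.Nat using (ℕ; _≤_)
open import Data.Product using (Σ; _×_)
open import Relation.Nullary using (¬_)
open import Relation.Binary.PropositionalEquality using (_≡_)

open import Data.Nat as ℕ using (zero; suc; _+_; _∸_; _<_; z≤n; s≤s; z<s)
open import Data.Nat.Properties
open import Data.Nat.Induction using (<-rec)
open import Data.Nat.Tactic.RingSolver using (solve-∀)
open import Data.Fin as F using (Fin; toℕ; fromℕ<; inject₁; fromℕ; cast) renaming (zero to fzero; suc to fsuc)
import Data.Fin.Properties as F
open import Data.Product
open import Data.Sum using (_⊎_; inj₁; inj₂; [_,_]′)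
open import Data.Unit using (tt)
open import Data.Empty using (⊥; ⊥-elim)
open import Data.List using (List; []; _∷_; length; filter; allFin; lookup)
open import Data.List.Extrema.Nat using (argmax; argmax-sel; f[xs]≤f[argmax]; argmin; f[argmin]≤f[xs])
open import Data.List.Membership.Propositional using (_∈_)
open import Data.List.Membership.Propositional.Properties using (∈-filter⁺; ∈-filter⁻; ∈-allFin; ∈-lookup)
open import Data.List.Relation.Binary.Permutation.Propositional using (↭-sym; ↭⇒↭ₛ)
open import Data.List.Relation.Binary.Permutation.Propositional.Properties using (↭-length; ∈-resp-↭)
import Data.List.Relation.Binary.Permutation.Setoid.Properties as PermutationSetoid
import Data.List.Relation.Unary.All as All
open import Data.List.Relation.Unary.AllPairs using (_∷_)
import Data.List.Relation.Unary.Any as Any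
open import Data.List.Relation.Unary.Any using (here; there)
open import Data.List.Relation.Unary.Any.Properties using (lookup-index)
open import Data.List.Relation.Unary.Sorted.TotalOrder.Properties using (lookup-mono-≤)
open import Data.List.Relation.Unary.Unique.Propositional using (Unique)
import Data.List.Relation.Unary.Unique.Propositional.Properties as Unique
import Data.List.Sort as Sort
open import Function using (_∘_)
open import Function.Bundles using (_⇔_; mk⇔; Equivalence)
open import Relation.Nullary
open import Relation.Nullary.Decidable using (_×-dec_; ¬?; _⊎-dec_)
import Relation.Unary as U
open import Relation.Binary.PropositionalEquality
open import Relation.Binary.Definitions using (tri<; tri≈; tri>)
open import Relation.Binary.Bundles using (DecTotalOrder)
import Relation.Binary.Construct.On as On
import Relation.Binary.Construct.Flip.EqAndOrd as Flip
i+[k∸j]<k : ∀ {i j k} → i < j → j ≤ k → i + (k ∸ j) < k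
i+[k∸j]<k {i} {j} {k} i<j j≤k = subst (i + (k ∸ j) <_) (m+[n∸m]≡n j≤k) (+-monoˡ-< (k ∸ j) i<j)

Even : ℕ → Set
Even n = Σ ℕ λ k → n ≡ k + k

private
  suc+suc : ∀ p → p + p + 2 ≡ suc p + suc p
  suc+suc = solve-∀

  suc[m+suc[n]]≡m+2+n : ∀ m n → suc (m + suc n) ≡ m + 2 + n
  suc[m+suc[n]]≡m+2+n = solve-∀

even-<⇒+2≤ : ∀ {m n} → Even m → Even n → m < n → m + 2 ≤ n
even-<⇒+2≤ (p , refl) (q , refl) p+p<q+q with <-cmp p q
... | tri< p<q _ _ = subst (_≤ q + q) (sym (suc+suc p)) (+-mono-≤ p<q p<q)
... | tri≈ _ refl _ = ⊥-elim (<-irrefl refl p+p<q+q)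
... | tri> _ _ q<p = ⊥-elim (<⇒≱ p+p<q+q (+-mono-≤ (<⇒≤ q<p) (<⇒≤ q<p)))

double-injective : ∀ p q → p + p ≡ q + q → p ≡ q
double-injective p q e = trans (n≡⌊n+n/2⌋ p) (trans (cong ℕ.⌊_/2⌋ e) (sym (n≡⌊n+n/2⌋ q)))

shortcut-cross-absurd : ∀ {xo xs yo ys e} → xo + 2 ≤ e + xs → e + ys ≤ yo → yo + xs ≡ ys + xo → ⊥
shortcut-cross-absurd {xo} {xs} {yo} {ys} {e} h₁ h₂ eq = m+1+n≰m (ys + xo + e) (begin
  ys + xo + e + 2     ≡⟨ r₁ ys xo e ⟩
  (e + ys) + (xo + 2) ≤⟨ +-mono-≤ h₂ h₁ ⟩
  yo + (e + xs)       ≡⟨ r₂ yo e xs ⟩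
  yo + xs + e         ≡⟨ cong (_+ e) eq ⟩
  ys + xo + e         ∎)
  where
  open ≤-Reasoning
  r₁ : ∀ ys xo e → ys + xo + e + 2 ≡ (e + ys) + (xo + 2)
  r₁ = solve-∀
  r₂ : ∀ yo e xs → yo + (e + xs) ≡ yo + xs + e
  r₂ = solve-∀

module _ {P : ℕ → Set} (P? : U.Decidable P) where
  least-witness : ∀ n → P n → Σ ℕ λ k → P k × (∀ j → P j → k ≤ j)
  least-witness = <-rec _ search
    where
    search : ∀ n → (∀ {m} → m < n → P m → Σ ℕ λ k → P k × (∀ j → P j → k ≤ j)) →
           P n → Σ ℕ λ k → P k × (∀ j → P j → k ≤ j)
    search n rec pn with anyUpTo? P? n
    ... | yes (m , m<n , pm) = rec m<n pm
    ... | no none = n , pn , λ j pj → ≮⇒≥ λ j<n → none (j , j<n , pj)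

distinct-three⇒2≤ : ∀ {n} (i j k : Fin n) → i ≢ j → i ≢ k → j ≢ k → 2 ≤ toℕ i ⊎ 2 ≤ toℕ j ⊎ 2 ≤ toℕ k
distinct-three⇒2≤ (fsuc (fsuc _)) _ _ _ _ _ = inj₁ (s≤s (s≤s z≤n))
distinct-three⇒2≤ _ (fsuc (fsuc _)) _ _ _ _ = inj₂ (inj₁ (s≤s (s≤s z≤n)))
distinct-three⇒2≤ _ _ (fsuc (fsuc _)) _ _ _ = inj₂ (inj₂ (s≤s (s≤s z≤n)))
distinct-three⇒2≤ fzero fzero _ i≢j _ _ = ⊥-elim (i≢j refl)
distinct-three⇒2≤ fzero (fsuc fzero) fzero _ i≢k _ = ⊥-elim (i≢k refl)
distinct-three⇒2≤ fzero (fsuc fzero) (fsuc fzero) _ _ j≢k = ⊥-elim (j≢k refl)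
distinct-three⇒2≤ (fsuc fzero) fzero fzero _ _ j≢k = ⊥-elim (j≢k refl)
distinct-three⇒2≤ (fsuc fzero) fzero (fsuc fzero) _ i≢k _ = ⊥-elim (i≢k refl)
distinct-three⇒2≤ (fsuc fzero) (fsuc fzero) _ i≢j _ _ = ⊥-elim (i≢j refl)

Unique-lookup-injective : ∀ {A : Set} {xs : List A} → Unique xs → ∀ i j → lookup xs i ≡ lookup xs j → i ≡ j
Unique-lookup-injective (_ ∷ _) fzero fzero _ = refl
Unique-lookup-injective (x∉ ∷ _) fzero (fsuc j) e = ⊥-elim (All.lookup x∉ (∈-lookup j) e)
Unique-lookup-injective (x∉ ∷ _) (fsuc i) fzero e = ⊥-elim (All.lookup x∉ (∈-lookup i) (sym e))
Unique-lookup-injective (_ ∷ u) (fsuc i) (fsuc j) e = cong fsuc (Unique-lookup-injective u i j e)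

cast-injective : ∀ {m n} .(eq : m ≡ n) (i j : Fin m) → cast eq i ≡ cast eq j → i ≡ j
cast-injective eq i j e = F.toℕ-injective (trans (sym (F.toℕ-cast eq i)) (trans (cong toℕ e) (F.toℕ-cast eq j)))

maximiser : ∀ {k} → (Fin k → ℕ) → Fin k → Fin k
maximiser f d = argmax f d (allFin _)

≤-maximiser : ∀ {k} (f : Fin k → ℕ) d j → f j ≤ f (maximiser f d)
≤-maximiser f d j = All.lookup (f[xs]≤f[argmax] {f = f} d (allFin _)) (∈-allFin j)

minimiser : ∀ {k} → (Fin k → ℕ) → Fin k → Fin k
minimiser f d = argmin f d (allFin _)

minimiser-≤ : ∀ {k} (f : Fin k → ℕ) d j → f (minimiser f d) ≤ f j
minimiser-≤ f d j = All.lookup (f[argmin]≤f[xs] {f = f} d (allFin _)) (∈-allFin j)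

Surj⇒≥ : ∀ {m k} {σ : Fin m → Fin k} → Surj σ → k ≤ m
Surj⇒≥ {σ = σ} onto = F.injective⇒≤ {f = proj₁ ∘ onto} λ {x} {y} e →
  trans (sym (proj₂ (onto x))) (trans (cong σ e) (proj₂ (onto y)))

module Walks (G : Graph) where

  AdjOrEq : V G → V G → Set
  AdjOrEq x y = Adj G x y ⊎ x ≡ y

  AdjOrEq-sym : ∀ {x y} → AdjOrEq x y → AdjOrEq y x
  AdjOrEq-sym (inj₁ a) = inj₁ (~-sym G a)
  AdjOrEq-sym (inj₂ e) = inj₂ (sym e)

  module _ {P : V G → Set} where
    start-holds : ∀ {u w k} → WalkIn G P u w k → P u
    start-holds (stop p) = p
    start-holds (step p _ _) = p

    end-holds : ∀ {u w k} → WalkIn G P u w k → P w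
    end-holds (stop p) = p
    end-holds (step _ _ W) = end-holds W

    infixr 5 _++ʷ_
    _++ʷ_ : ∀ {u v w k l} → WalkIn G P u v k → WalkIn G P v w l → WalkIn G P u w (k + l)
    stop _ ++ʷ W = W
    step p a W ++ʷ W′ = step p a (W ++ʷ W′)

    snocʷ : ∀ {u v w k} → WalkIn G P u v k → Adj G v w → P w → WalkIn G P u w (suc k)
    snocʷ (stop p) a q = step p a (stop q)
    snocʷ (step p a W) b q = step p a (snocʷ W b q)

    reverseʷ : ∀ {u w k} → WalkIn G P u w k → WalkIn G P w u k
    reverseʷ (stop p) = stop p
    reverseʷ (step p a W) = snocʷ (reverseʷ W) (~-sym G a) p

    vertexAt : ∀ {u w k} → WalkIn G P u w k → Fin (suc k) → V G
    vertexAt {u} W fzero = u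
    vertexAt (step _ _ W) (fsuc i) = vertexAt W i

    vertexAt-holds : ∀ {u w k} (W : WalkIn G P u w k) i → P (vertexAt W i)
    vertexAt-holds W fzero = start-holds W
    vertexAt-holds (step _ _ W) (fsuc i) = vertexAt-holds W i

    vertexAt-last : ∀ {u w k} (W : WalkIn G P u w k) → vertexAt W (fromℕ k) ≡ w
    vertexAt-last (stop _) = refl
    vertexAt-last (step _ _ W) = vertexAt-last W

    vertexAt-adj : ∀ {u w k} (W : WalkIn G P u w k) (i : Fin k) →
                   Adj G (vertexAt W (inject₁ i)) (vertexAt W (fsuc i))
    vertexAt-adj (step _ a W) fzero = a
    vertexAt-adj (step _ _ W) (fsuc i) = vertexAt-adj W i

    splitAt : ∀ {u w k} (W : WalkIn G P u w k) (i : Fin (suc k)) →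
              WalkIn G P u (vertexAt W i) (toℕ i) × WalkIn G P (vertexAt W i) w (k ∸ toℕ i)
    splitAt W fzero = stop (start-holds W) , W
    splitAt (step p a W) (fsuc i) = let (A , B) = splitAt W i in step p a A , B

    length-zero⇒≡ : ∀ {u w} → WalkIn G P u w 0 → u ≡ w
    length-zero⇒≡ (stop _) = refl

    walkIn? : U.Decidable P → ∀ k u w → Dec (WalkIn G P u w k)
    walkIn? P? zero u w with P? u | u F.≟ w
    ... | yes p | yes refl = yes (stop p)
    ... | no ¬p | _ = no λ W → ¬p (start-holds W)
    ... | yes p | no u≢w = no λ W → u≢w (length-zero⇒≡ W)
    walkIn? P? (suc k) u w with P? u | F.any? (λ x → ~-dec G u x ×-dec walkIn? P? k x w)
    ... | yes p | yes (x , a , W) = yes (step p a W)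
    ... | no ¬p | _ = no λ W → ¬p (start-holds W)
    ... | yes p | no ¬e = no λ { (step _ a W) → ¬e (_ , a , W) }

  mapʷ : ∀ {P Q : V G → Set} {u w k} → (∀ {x} → P x → Q x) → WalkIn G P u w k → WalkIn G Q u w k
  mapʷ h (stop p) = stop (h p)
  mapʷ h (step p a W) = step (h p) a (mapʷ h W)

  restrictʷ : ∀ {P Q : V G → Set} {u w k} (W : WalkIn G P u w k) →
              (∀ i → Q (vertexAt W i)) → WalkIn G Q u w k
  restrictʷ (stop p) q = stop (q fzero)
  restrictʷ (step p a W) q = step (q fzero) a (restrictʷ W (q ∘ fsuc))

module _ {G : Graph} {P : V G → Set} where
  open Walks G

  cut-revisit : ∀ {u w k} (W : WalkIn G P u w k) i j → vertexAt W i ≡ vertexAt W j →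
                WalkIn G P u w (toℕ i + (k ∸ toℕ j))
  cut-revisit {w = w} {k} W i j e =
    proj₁ (splitAt W i) ++ʷ subst (λ z → WalkIn G P z w (k ∸ toℕ j)) (sym e) (proj₂ (splitAt W j))

  shortest-injective : ∀ {u w k} (W : WalkIn G P u w k) → (∀ j → WalkIn G P u w j → k ≤ j) →
                       ∀ i j → vertexAt W i ≡ vertexAt W j → i ≡ j
  shortest-injective W minimal i j e with <-cmp (toℕ i) (toℕ j)
  ... | tri≈ _ i≡j _ = F.toℕ-injective i≡j
  ... | tri< i<j _ _ = ⊥-elim (<⇒≱ (i+[k∸j]<k i<j (F.toℕ≤pred[n] j)) (minimal _ (cut-revisit W i j e)))
  ... | tri> _ _ j<i = ⊥-elim (<⇒≱ (i+[k∸j]<k j<i (F.toℕ≤pred[n] i)) (minimal _ (cut-revisit W j i (sym e))))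

private
  to-zero : ∀ {k} (P : Fin (suc k) → Set) → (∀ (i : Fin k) → P (fsuc i) → P (inject₁ i)) →
            ∀ i → P i → P fzero
  to-zero P back fzero p = p
  to-zero {suc k} P back (fsuc i) p = to-zero (P ∘ inject₁) (back ∘ inject₁) i (back i p)

  from-zero : ∀ {k} (P : Fin (suc k) → Set) → (∀ (i : Fin k) → P (inject₁ i) → P (fsuc i)) →
              P fzero → ∀ i → P i
  from-zero P fwd p fzero = p
  from-zero {suc k} P fwd p (fsuc i) = fwd i (from-zero (P ∘ inject₁) (fwd ∘ inject₁) p i)

pathAdj-closed⇒all : ∀ {m} (P : Fin (suc m) → Set) → (∀ u v → pathAdj u v → P u → P v) →
                     ∀ i j → P i → P j
pathAdj-closed⇒all {m} P closed i j p = from-zero P fwd (to-zero P back i p) j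
  where
  fwd : ∀ (i : Fin m) → P (inject₁ i) → P (fsuc i)
  fwd i = closed _ _ (inj₁ (cong suc (sym (F.toℕ-inject₁ i))))
  back : ∀ (i : Fin m) → P (fsuc i) → P (inject₁ i)
  back i = closed _ _ (inj₂ (cong suc (sym (F.toℕ-inject₁ i))))

pathAdj-edge : ∀ {m} {u v : Fin (suc m)} → toℕ v ≡ suc (toℕ u) → Σ (Fin m) λ i → inject₁ i ≡ u × fsuc i ≡ v
pathAdj-edge {v = fsuc i} e = i , F.toℕ-injective (trans (F.toℕ-inject₁ i) (suc-injective e)) , refl

module _ {H : Graph} where
  open Walks H

  consecutive⇒WeakHom : ∀ {m} (f : Fin (suc m) → V H) → (∀ (i : Fin m) → AdjOrEq (f (inject₁ i)) (f (fsuc i))) →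
                        WeakHom (PathGraph (suc m)) H f
  consecutive⇒WeakHom f steps u v (inj₁ e) with pathAdj-edge e
  ... | i , refl , refl = steps i
  consecutive⇒WeakHom f steps u v (inj₂ e) with pathAdj-edge e
  ... | i , refl , refl = AdjOrEq-sym (steps i)

pathAdj-suc : ∀ {m} {i j : Fin m} → pathAdj i j → pathAdj (fsuc i) (fsuc j)
pathAdj-suc (inj₁ e) = inj₁ (cong suc e)
pathAdj-suc (inj₂ e) = inj₂ (cong suc e)

pathAdj-at-most-two : ∀ {m} {i j₁ j₂ j₃ : Fin m} → pathAdj i j₁ → pathAdj i j₂ → pathAdj i j₃ →
                      j₁ ≡ j₂ ⊎ j₁ ≡ j₃ ⊎ j₂ ≡ j₃
pathAdj-at-most-two (inj₁ a) (inj₁ b) _ = inj₁ (F.toℕ-injective (trans a (sym b)))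
pathAdj-at-most-two (inj₂ a) (inj₂ b) _ = inj₁ (F.toℕ-injective (suc-injective (trans (sym a) b)))
pathAdj-at-most-two (inj₁ a) (inj₂ _) (inj₁ c) = inj₂ (inj₁ (F.toℕ-injective (trans a (sym c))))
pathAdj-at-most-two (inj₁ _) (inj₂ b) (inj₂ c) = inj₂ (inj₂ (F.toℕ-injective (suc-injective (trans (sym b) c))))
pathAdj-at-most-two (inj₂ a) (inj₁ _) (inj₂ c) = inj₂ (inj₁ (F.toℕ-injective (suc-injective (trans (sym a) c))))
pathAdj-at-most-two (inj₂ _) (inj₁ b) (inj₁ c) = inj₂ (inj₂ (F.toℕ-injective (trans b (sym c))))

-- 0, 1, …, k + 1, k
up-then-back : ∀ {k} → Fin (3 + k) → Fin (2 + k)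
up-then-back fzero = fzero
up-then-back {zero} (fsuc fzero) = fsuc fzero
up-then-back {zero} (fsuc (fsuc fzero)) = fzero
up-then-back {suc k} (fsuc i) = fsuc (up-then-back i)

-- 1, 0, 1, …, k + 1
back-then-up : ∀ {k} → Fin (3 + k) → Fin (2 + k)
back-then-up fzero = fsuc fzero
back-then-up (fsuc i) = i

up-then-back-step : ∀ {k} (i : Fin (2 + k)) → pathAdj (up-then-back (inject₁ i)) (up-then-back (fsuc i))
up-then-back-step {zero} fzero = inj₁ refl
up-then-back-step {zero} (fsuc fzero) = inj₂ refl
up-then-back-step {suc k} fzero = inj₁ refl
up-then-back-step {suc k} (fsuc i) = pathAdj-suc (up-then-back-step i)

back-then-up-step : ∀ {k} (i : Fin (2 + k)) → pathAdj (back-then-up (inject₁ i)) (back-then-up (fsuc i))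
back-then-up-step fzero = inj₂ refl
back-then-up-step (fsuc i) = inj₁ (cong suc (sym (F.toℕ-inject₁ i)))

up-then-back-inject₁ : ∀ {k} (i : Fin (2 + k)) → up-then-back (inject₁ i) ≡ i
up-then-back-inject₁ {zero} fzero = refl
up-then-back-inject₁ {zero} (fsuc fzero) = refl
up-then-back-inject₁ {suc k} fzero = refl
up-then-back-inject₁ {suc k} (fsuc i) = cong fsuc (up-then-back-inject₁ i)

up-back-adjacent : ∀ {k} (t : Fin (3 + k)) → pathAdj (up-then-back t) (back-then-up t)
up-back-adjacent fzero = inj₁ refl
up-back-adjacent {zero} (fsuc fzero) = inj₂ refl
up-back-adjacent {zero} (fsuc (fsuc fzero)) = inj₁ refl
up-back-adjacent {suc k} (fsuc fzero) = inj₂ refl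
up-back-adjacent {suc k} (fsuc (fsuc i)) = pathAdj-suc (up-back-adjacent (fsuc i))

adjacent-pair-on-path : ∀ {T : Graph} {k} (σ : Fin (2 + k) → V T) → Surj σ →
                        (∀ i j → pathAdj i j → Adj T (σ i) (σ j)) →
                        SurjPair T (2 + k) (σ ∘ up-then-back) (σ ∘ back-then-up) ×
                        (∀ t → Adj T (σ (up-then-back t)) (σ (back-then-up t)))
adjacent-pair-on-path {T} σ onto adj =
  ( consecutive⇒WeakHom {T} _ (λ i → inj₁ (adj _ _ (up-then-back-step i)))
  , consecutive⇒WeakHom {T} _ (λ i → inj₁ (adj _ _ (back-then-up-step i)))
  , (λ y → let (i , e) = onto y in inject₁ i , trans (cong σ (up-then-back-inject₁ i)) e)
  , (λ y → let (i , e) = onto y in fsuc i , e) )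
  , λ t → adj _ _ (up-back-adjacent t)

module Distance (G : Graph) (conn : Connected G) where
  open Walks G

  abstract
    shortest : ∀ u w → Σ ℕ λ k → Walk G u w k × (∀ j → Walk G u w j → k ≤ j)
    shortest u w = least-witness (λ k → walkIn? (λ _ → yes tt) k u w) (proj₁ (conn u w)) (proj₂ (conn u w))

    dist : V G → V G → ℕ
    dist u w = proj₁ (shortest u w)

    geodesic : ∀ u w → Walk G u w (dist u w)
    geodesic u w = proj₁ (proj₂ (shortest u w))

    dist-minimal : ∀ {u w j} → Walk G u w j → dist u w ≤ j
    dist-minimal {u} {w} {j} W = proj₂ (proj₂ (shortest u w)) j W

  Dist-dist : ∀ u w → Dist G u w (dist u w)
  Dist-dist u w = geodesic u w , λ _ → dist-minimal

  Dist⇒≡dist : ∀ {u w k} → Dist G u w k → k ≡ dist u w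
  Dist⇒≡dist (W , minimal) = ≤-antisym (minimal _ (geodesic _ _)) (dist-minimal W)

  dist-refl : ∀ u → dist u u ≡ 0
  dist-refl u = n≤0⇒n≡0 (dist-minimal (stop {u = u} tt))

  dist≡0⇒≡ : ∀ {u w} → dist u w ≡ 0 → u ≡ w
  dist≡0⇒≡ {u} {w} e = length-zero⇒≡ (subst (Walk G u w) e (geodesic u w))

  ≢⇒dist>0 : ∀ {u w} → u ≢ w → 0 < dist u w
  ≢⇒dist>0 u≢w = n≢0⇒n>0 (u≢w ∘ dist≡0⇒≡)

  dist-sym : ∀ u w → dist u w ≡ dist w u
  dist-sym u w = ≤-antisym (dist-minimal (reverseʷ (geodesic w u))) (dist-minimal (reverseʷ (geodesic u w)))

  dist-triangle : ∀ u v w → dist u w ≤ dist u v + dist v w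
  dist-triangle u v w = dist-minimal (geodesic u v ++ʷ geodesic v w)

  dist-adjˡ-≤ : ∀ {u x} w → Adj G u x → dist u w ≤ suc (dist x w)
  dist-adjˡ-≤ w a = dist-minimal (step tt a (geodesic _ w))

  dist-adjʳ-≤ : ∀ z {x y} → Adj G x y → dist z y ≤ suc (dist z x)
  dist-adjʳ-≤ z {x} xy = dist-minimal (snocʷ (geodesic z x) xy tt)

  adj⇒dist≡1 : ∀ {u x} → Adj G u x → dist u x ≡ 1
  adj⇒dist≡1 {u} {x} a = ≤-antisym (dist-minimal (step tt a (stop {u = x} tt)))
    (≢⇒dist>0 λ { refl → ~-irr G a })

  Between : V G → V G → V G → Set
  Between p q u = dist p u + dist u q ≡ dist p q

  Between⇒dist≤ : ∀ {p q u} → Between p q u → dist u q ≤ dist p q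
  Between⇒dist≤ {p} {q} {u} b = subst (dist u q ≤_) b (m≤n+m (dist u q) (dist p u))

  shortest-vertexAt-Between : ∀ {p q k} (W : Walk G p q k) → dist p q ≡ k → ∀ i → Between p q (vertexAt W i)
  shortest-vertexAt-Between {p} {q} {k} W d≡k i = ≤-antisym (begin
      dist p u + dist u q          ≤⟨ +-mono-≤ (dist-minimal A) (dist-minimal B) ⟩
      toℕ i + (k ∸ toℕ i)          ≡⟨ m+[n∸m]≡n (F.toℕ≤pred[n] i) ⟩
      k                            ≡⟨ sym d≡k ⟩
      dist p q                     ∎)
    (dist-triangle p u q)
    where
    open ≤-Reasoning
    u = vertexAt W i
    A = proj₁ (splitAt W i)
    B = proj₂ (splitAt W i)

  geodesicBetween : ∀ p q → WalkIn G (Between p q) p q (dist p q)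
  geodesicBetween p q = restrictʷ (geodesic p q) (shortest-vertexAt-Between (geodesic p q) refl)

  -- the first vertex of some geodesic from u to w (or u itself when u ≡ w)
  abstract
    next : V G → V G → V G
    next u w with F.any? (λ x → ~-dec G u x ×-dec (suc (dist x w) ℕ.≟ dist u w))
    ... | yes (x , _) = x
    ... | no _ = u

    next-spec : ∀ {u w} → u ≢ w → Adj G u (next u w) × suc (dist (next u w) w) ≡ dist u w
    next-spec {u} {w} u≢w with F.any? (λ x → ~-dec G u x ×-dec (suc (dist x w) ℕ.≟ dist u w))
    ... | yes (x , p) = p
    ... | no none = ⊥-elim (none (first-step (geodesic u w) refl))
      where
      first-step : ∀ {k} → Walk G u w k → dist u w ≡ k →
                   Σ (V G) λ x → Adj G u x × suc (dist x w) ≡ dist u w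
      first-step (stop _) _ = ⊥-elim (u≢w refl)
      first-step (step {w = x} _ a W) d≡k =
        x , a , ≤-antisym (subst (suc (dist x w) ≤_) (sym d≡k) (s≤s (dist-minimal W))) (dist-adjˡ-≤ w a)

  next-adj : ∀ {u w} → u ≢ w → Adj G u (next u w)
  next-adj u≢w = proj₁ (next-spec u≢w)

  next-closer : ∀ {u w} → u ≢ w → dist (next u w) w < dist u w
  next-closer u≢w = ≤-reflexive (proj₂ (next-spec u≢w))

module Tree (G : Graph) (conn : Connected G) (acyclic : ¬ HasCycle G) where
  open Walks G
  open Distance G conn

  cycle-around : ∀ {v x y m} (W : WalkIn G (_≢ v) x y (suc m)) →
                 (∀ i j → vertexAt W i ≡ vertexAt W j → i ≡ j) → Adj G v x → Adj G y v → HasCycle G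
  cycle-around {v} {m = m} W W-injective vx yv = m , c , c-injective , c-adj , c-closes
    where
    c : Fin (suc (suc (suc m))) → V G
    c fzero = v
    c (fsuc i) = vertexAt W i
    c-injective : ∀ i j → c i ≡ c j → i ≡ j
    c-injective fzero fzero _ = refl
    c-injective fzero (fsuc j) e = ⊥-elim (vertexAt-holds W j (sym e))
    c-injective (fsuc i) fzero e = ⊥-elim (vertexAt-holds W i e)
    c-injective (fsuc i) (fsuc j) e = cong fsuc (W-injective i j e)
    c-adj : ∀ (i : Fin (suc (suc m))) → Adj G (c (inject₁ i)) (c (fsuc i))
    c-adj fzero = vx
    c-adj (fsuc i) = vertexAt-adj W i
    c-closes : Adj G (c (fromℕ (suc (suc m)))) (c fzero)
    c-closes = subst (λ z → Adj G z v) (sym (vertexAt-last W)) yv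

  no-bypass : ∀ {v x y k} → Adj G v x → Adj G v y → x ≢ y → ¬ WalkIn G (_≢ v) x y k
  no-bypass {v} {x} {y} {k} vx vy x≢y W
    with least-witness (λ j → walkIn? (λ z → ¬? (z F.≟ v)) j x y) k W
  ... | zero , W₀ , _ = x≢y (length-zero⇒≡ W₀)
  ... | suc m , W₁ , minimal = acyclic (cycle-around W₁ (shortest-injective W₁ minimal) vx (~-sym G vy))

  Between⇒avoids : ∀ {x z v u} → dist x z < dist v z → Between x z u → u ≢ v
  Between⇒avoids x<v b refl = <⇒≱ x<v (Between⇒dist≤ b)

  geodesic-avoiding : ∀ {x z} v → dist x z < dist v z → WalkIn G (_≢ v) x z (dist x z)
  geodesic-avoiding v x<v = mapʷ (Between⇒avoids x<v) (geodesicBetween _ _)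

  from-next : ∀ {v u} → v ≢ u → WalkIn G (_≢ v) (next v u) u (dist (next v u) u)
  from-next v≢u = geodesic-avoiding _ (next-closer v≢u)

  closer-neighbour-unique : ∀ {u x y z} → Adj G u x → Adj G u y →
                            dist x z < dist u z → dist y z < dist u z → x ≡ y
  closer-neighbour-unique ux uy x<u y<u with _ F.≟ _
  ... | yes x≡y = x≡y
  ... | no x≢y = ⊥-elim (no-bypass ux uy x≢y
                   (geodesic-avoiding _ x<u ++ʷ reverseʷ (geodesic-avoiding _ y<u)))

  next-unique : ∀ {u x z} → Adj G u x → dist x z < dist u z → x ≡ next u z
  next-unique {u} {x} {z} ux x<u = closer-neighbour-unique ux (next-adj u≢z) x<u (next-closer u≢z)
    where
    u≢z : u ≢ z
    u≢z refl = n≮0 (subst (dist x u <_) (dist-refl u) x<u)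

  next-of-neighbour : ∀ {v x} → Adj G v x → next v x ≡ x
  next-of-neighbour {v} {x} vx = sym (next-unique vx (begin-strict
    dist x x ≡⟨ dist-refl x ⟩
    0        <⟨ z<s ⟩
    1        ≡⟨ sym (adj⇒dist≡1 vx) ⟩
    dist v x ∎))
    where open ≤-Reasoning

  -- otherwise w and next u z would be joined by a walk through z avoiding u
  adj⇒dist≢ : ∀ {u w} z → Adj G u w → dist u z ≢ dist w z
  adj⇒dist≢ {u} {w} z uw e with u F.≟ z
  ... | yes refl = ~-irr G (subst (Adj G u) (dist≡0⇒≡ (trans (sym e) (dist-refl u))) uw)
  ... | no u≢z = no-bypass uw (next-adj u≢z) w≢next
                   (step w≢u (next-adj w≢z) (geodesic-avoiding u p<u) ++ʷ
                    reverseʷ (geodesic-avoiding u (next-closer u≢z)))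
    where
    w≢z : w ≢ z
    w≢z refl = u≢z (dist≡0⇒≡ (trans e (dist-refl w)))
    w≢u : w ≢ u
    w≢u refl = ~-irr G uw
    p<u : dist (next w z) z < dist u z
    p<u = subst (dist (next w z) z <_) (sym e) (next-closer w≢z)
    w≢next : w ≢ next u z
    w≢next refl = <⇒≢ (next-closer u≢z) (sym e)

  adj⇒dist-suc : ∀ z {u w} → Adj G u w → suc (dist z u) ≡ dist z w ⊎ suc (dist z w) ≡ dist z u
  adj⇒dist-suc z {u} {w} uw with <-cmp (dist z u) (dist z w)
  ... | tri≈ _ e _ = ⊥-elim (adj⇒dist≢ z uw (trans (dist-sym u z) (trans e (dist-sym z w))))
  ... | tri< u<w _ _ = inj₁ (≤-antisym u<w (dist-adjʳ-≤ z uw))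
  ... | tri> _ _ w<u = inj₂ (≤-antisym w<u (dist-adjʳ-≤ z (~-sym G uw)))

  avoiding⇒same-next : ∀ {v u w k} → WalkIn G (_≢ v) u w k → next v u ≡ next v w
  avoiding⇒same-next {v} {u} {w} W with next v u F.≟ next v w
  ... | yes e = e
  ... | no ne = ⊥-elim (no-bypass (next-adj v≢u) (next-adj v≢w) ne
                  (from-next v≢u ++ʷ W ++ʷ reverseʷ (from-next v≢w)))
    where
    v≢u = ≢-sym (start-holds W)
    v≢w = ≢-sym (end-holds W)

  same-next⇒SameComp : ∀ {v u w} → u ≢ v → w ≢ v → next v u ≡ next v w → SameComp G v u w
  same-next⇒SameComp {v} {u} {w} u≢v w≢v e =
    _ , reverseʷ (from-next (≢-sym u≢v)) ++ʷ
        subst (λ x → WalkIn G (_≢ v) x w (dist (next v w) w)) (sym e) (from-next (≢-sym w≢v))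

  next≢⇒dist-via : ∀ {v u w} → next v u ≢ next v w → dist u v + dist v w ≤ dist u w
  next≢⇒dist-via {v} {u} {w} ne with F.any? (λ i → vertexAt (geodesic u w) i F.≟ v)
  ... | yes (i , e) = ≤-reflexive (subst (Between u w) e (shortest-vertexAt-Between (geodesic u w) refl i))
  ... | no ¬hit = ⊥-elim (ne (avoiding⇒same-next (restrictʷ (geodesic u w) (λ i e → ¬hit (i , e)))))

  same-next⇒shortcut : ∀ {x u w} → u ≢ x → w ≢ x → next x u ≡ next x w →
                       dist u w + 2 ≤ dist u x + dist x w
  same-next⇒shortcut {x} {u} {w} u≢x w≢x e = begin
      dist u w + 2                     ≤⟨ +-monoˡ-≤ 2 (dist-triangle u p w) ⟩
      dist u p + dist p w + 2          ≡⟨ cong (λ t → t + dist p w + 2) (dist-sym u p) ⟩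
      dist p u + dist p w + 2          ≡⟨ +-assoc (dist p u) (dist p w) 2 ⟩
      dist p u + (dist p w + 2)        ≡⟨ cong (dist p u +_) (+-comm (dist p w) 2) ⟩
      dist p u + suc (suc (dist p w))  ≡⟨ +-suc (dist p u) (suc (dist p w)) ⟩
      suc (dist p u) + suc (dist p w)  ≡⟨ cong₂ _+_ (proj₂ (next-spec x≢u)) p-w ⟩
      dist x u + dist x w              ≡⟨ cong (_+ dist x w) (dist-sym x u) ⟩
      dist u x + dist x w              ∎
    where
    open ≤-Reasoning
    x≢u = ≢-sym u≢x
    p = next x u
    p-w : suc (dist p w) ≡ dist x w
    p-w = subst (λ q → suc (dist q w) ≡ dist x w) (sym e) (proj₂ (next-spec (≢-sym w≢x)))

  Between⇒same-next : ∀ {v u z} → u ≢ v → Between v z u → next v u ≡ next v z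
  Between⇒same-next {v} {u} {z} u≢v b with next v u F.≟ next v z
  ... | yes e = e
  ... | no ne = ⊥-elim (<⇒≱ (≢⇒dist>0 u≢v)
                  (+-cancelʳ-≤ (dist v z) (dist u v) 0 (≤-trans (next≢⇒dist-via ne) (Between⇒dist≤ b))))

  -- for D > 0, Triod v D holds exactly when η(v) ≥ D
  Triod : V G → ℕ → Set
  Triod v D = Σ (V G) λ w₁ → Σ (V G) λ w₂ → Σ (V G) λ w₃ →
    (w₁ ≢ v × w₂ ≢ v × w₃ ≢ v) ×
    (next v w₁ ≢ next v w₂ × next v w₁ ≢ next v w₃ × next v w₂ ≢ next v w₃) ×
    (D ≤ dist v w₁ × D ≤ dist v w₂ × D ≤ dist v w₃)

  Triod-mono : ∀ {v D D′} → D ≤ D′ → Triod v D′ → Triod v D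
  Triod-mono D≤D′ (w₁ , w₂ , w₃ , avoid , branches , l₁ , l₂ , l₃) =
    w₁ , w₂ , w₃ , avoid , branches , ≤-trans D≤D′ l₁ , ≤-trans D≤D′ l₂ , ≤-trans D≤D′ l₃

  IsPathGraph⇒no-Triod : IsPathGraph G → ∀ v D → ¬ Triod v D
  IsPathGraph⇒no-Triod (_ , σ , _ , onto , adj) v D (w₁ , w₂ , w₃ , (w₁≢v , w₂≢v , w₃≢v) , (d₁₂ , d₁₃ , d₂₃) , _)
    with pathAdj-at-most-two (step-index w₁≢v) (step-index w₂≢v) (step-index w₃≢v)
    where
    index : V G → Fin _
    index = proj₁ ∘ onto
    step-index : ∀ {w} → w ≢ v → pathAdj (index v) (index (next v w))
    step-index {w} w≢v = Equivalence.from (adj (index v) (index (next v w)))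
      (subst₂ (Adj G) (sym (proj₂ (onto v))) (sym (proj₂ (onto (next v w)))) (next-adj (≢-sym w≢v)))
  ... | inj₁ e = d₁₂ (trans (sym (proj₂ (onto _))) (trans (cong σ e) (proj₂ (onto _))))
  ... | inj₂ (inj₁ e) = d₁₃ (trans (sym (proj₂ (onto _))) (trans (cong σ e) (proj₂ (onto _))))
  ... | inj₂ (inj₂ e) = d₂₃ (trans (sym (proj₂ (onto _))) (trans (cong σ e) (proj₂ (onto _))))

  Fin3⇒Triod : ∀ {v D} (w : Fin 3 → V G) → (∀ i → w i ≢ v) → (∀ i → D ≤ dist v (w i)) →
               (∀ i j → next v (w i) ≡ next v (w j) → i ≡ j) → Triod v D
  Fin3⇒Triod w avoid far distinct =
    w 0F , w 1F , w 2F , (avoid 0F , avoid 1F , avoid 2F) ,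
    ((λ ()) ∘ distinct 0F 1F , (λ ()) ∘ distinct 0F 2F , (λ ()) ∘ distinct 1F 2F) ,
    (far 0F , far 1F , far 2F)
    where
    0F 1F 2F : Fin 3
    0F = fzero
    1F = fsuc fzero
    2F = fsuc (fsuc fzero)

  TriodAt⇒Triod : ∀ {v e} → TriodAt G v e → 0 < e → Triod v e
  TriodAt⇒Triod (inj₁ (_ , refl)) ()
  TriodAt⇒Triod {v} (inj₂ (2<d , c , r , c≢v , c-distinct , _ , c-reach , c-sorted , refl)) 0<e =
    Fin3⇒Triod (proj₁ ∘ leg) (proj₁ ∘ proj₂ ∘ leg) far distinct
    where
    idx : Fin 3 → Fin (deg G v)
    idx i = F.inject≤ i 2<d
    e≤r : ∀ i → r (fromℕ< 2<d) ≤ r (idx i)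
    e≤r i = c-sorted (idx i) (fromℕ< 2<d)
      (subst₂ _≤_ (sym (F.toℕ-inject≤ i 2<d)) (sym (F.toℕ-fromℕ< 2<d)) (F.toℕ≤pred[n] i))
    leg : ∀ i → Σ (V G) λ w → w ≢ v × next v (c (idx i)) ≡ next v w × r (idx i) ≡ dist v w
    leg i with proj₁ (c-reach (idx i))
    ... | w , inj₁ (_ , W) , d = w , end-holds W , avoiding⇒same-next W , Dist⇒≡dist d
    ... | w , inj₂ refl , d = ⊥-elim (<⇒≱ 0<e (≤-trans (e≤r i) (≤-reflexive (trans (Dist⇒≡dist d) (dist-refl v)))))
    far : ∀ i → r (fromℕ< 2<d) ≤ dist v (proj₁ (leg i))
    far i = ≤-trans (e≤r i) (≤-reflexive (proj₂ (proj₂ (proj₂ (leg i)))))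
    distinct : ∀ i j → next v (proj₁ (leg i)) ≡ next v (proj₁ (leg j)) → i ≡ j
    distinct i j e = F.inject≤-injective _ _ i j (c-distinct (idx i) (idx j)
      (same-next⇒SameComp (c≢v (idx i)) (c≢v (idx j))
        (trans (proj₁ (proj₂ (proj₂ (leg i)))) (trans e (sym (proj₁ (proj₂ (proj₂ (leg j)))))))))

module Spine (G : Graph) (conn : Connected G) (acyclic : ¬ HasCycle G) (a b : V G)
             (diametral : ∀ u w → Distance.dist G conn u w ≤ Distance.dist G conn a b) where
  open Walks G
  open Distance G conn
  open Tree G conn acyclic

  L : ℕ
  L = dist a b

  OnSpine : V G → Set
  OnSpine w = dist a w + dist b w ≡ L

  -- twice the distance from a to the vertex where w is attached to the spine
  β : V G → ℕ
  β w = dist a w + L ∸ dist b w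

  β-spec : ∀ w → β w + dist b w ≡ dist a w + L
  β-spec w = m∸n+n≡m (≤-trans (diametral b w) (m≤n+m L (dist a w)))

  a-OnSpine : OnSpine a
  a-OnSpine = trans (cong (_+ dist b a) (dist-refl a)) (dist-sym b a)

  β-a : β a ≡ 0
  β-a = +-cancelʳ-≡ (dist b a) (β a) 0 (begin
    β a + dist b a  ≡⟨ β-spec a ⟩
    dist a a + L    ≡⟨ cong (_+ L) (dist-refl a) ⟩
    L               ≡⟨ dist-sym a b ⟩
    dist b a        ∎)
    where open ≡-Reasoning

  β-b : β b ≡ L + L
  β-b = +-cancelʳ-≡ (dist b b) (β b) (L + L) (begin
    β b + dist b b  ≡⟨ β-spec b ⟩
    L + L           ≡⟨ sym (+-identityʳ (L + L)) ⟩
    L + L + 0       ≡⟨ cong (L + L +_) (sym (dist-refl b)) ⟩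
    L + L + dist b b ∎)
    where open ≡-Reasoning

  dist-a≤β : ∀ w → dist a w ≤ β w
  dist-a≤β w = +-cancelʳ-≤ (dist b w) (dist a w) (β w)
    (≤-trans (+-monoʳ-≤ (dist a w) (diametral b w)) (≤-reflexive (sym (β-spec w))))

  β≤L+L : ∀ w → β w ≤ L + L
  β≤L+L w = ≤-trans (m≤m+n (β w) (dist b w)) (≤-trans (≤-reflexive (β-spec w)) (+-monoˡ-≤ L (diametral a w)))

  OnSpine⇒β : ∀ {w} → OnSpine w → β w ≡ dist a w + dist a w
  OnSpine⇒β {w} on = +-cancelʳ-≡ (dist b w) (β w) (dist a w + dist a w) (begin
    β w + dist b w               ≡⟨ β-spec w ⟩
    dist a w + L                 ≡⟨ cong (dist a w +_) (sym on) ⟩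
    dist a w + (dist a w + dist b w) ≡⟨ sym (+-assoc (dist a w) (dist a w) (dist b w)) ⟩
    dist a w + dist a w + dist b w ∎)
    where open ≡-Reasoning

  next≢⇒OnSpine : ∀ {x} → next x a ≢ next x b → OnSpine x
  next≢⇒OnSpine {x} ne = subst (λ t → dist a x + t ≡ L) (dist-sym x b)
    (≤-antisym (next≢⇒dist-via ne) (dist-triangle a x b))

  data Move (x x′ : V G) : Set where
    level : β x′ ≡ β x → Move x x′
    up    : β x′ ≡ β x + 2 → OnSpine x → OnSpine x′ → Move x x′
    down  : β x ≡ β x′ + 2 → OnSpine x → OnSpine x′ → Move x x′

  level-step : ∀ {x x′} → suc (dist a x) ≡ dist a x′ → suc (dist b x) ≡ dist b x′ → β x′ ≡ β x
  level-step {x} {x′} ea eb = +-cancelʳ-≡ (dist b x) (β x′) (β x) (suc-injective (begin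
    suc (β x′ + dist b x)  ≡⟨ sym (+-suc (β x′) (dist b x)) ⟩
    β x′ + suc (dist b x)  ≡⟨ cong (β x′ +_) eb ⟩
    β x′ + dist b x′       ≡⟨ β-spec x′ ⟩
    dist a x′ + L          ≡⟨ cong (_+ L) (sym ea) ⟩
    suc (dist a x + L)     ≡⟨ cong suc (sym (β-spec x)) ⟩
    suc (β x + dist b x)   ∎))
    where open ≡-Reasoning

  up-step : ∀ {x x′} → Adj G x x′ → suc (dist a x) ≡ dist a x′ → suc (dist b x′) ≡ dist b x →
            β x′ ≡ β x + 2 × OnSpine x × OnSpine x′
  up-step {x} {x′} xx′ ea eb = β-up , x-on , x′-on
    where
    open ≡-Reasoning
    β-up : β x′ ≡ β x + 2
    β-up = +-cancelʳ-≡ (dist b x′) (β x′) (β x + 2) (begin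
      β x′ + dist b x′             ≡⟨ β-spec x′ ⟩
      dist a x′ + L                ≡⟨ cong (_+ L) (sym ea) ⟩
      suc (dist a x + L)           ≡⟨ cong suc (sym (β-spec x)) ⟩
      suc (β x + dist b x)         ≡⟨ cong (λ t → suc (β x + t)) (sym eb) ⟩
      suc (β x + suc (dist b x′))  ≡⟨ suc[m+suc[n]]≡m+2+n (β x) (dist b x′) ⟩
      β x + 2 + dist b x′          ∎)
    x-on : OnSpine x
    x-on with x F.≟ a
    ... | yes refl = a-OnSpine
    ... | no x≢a = next≢⇒OnSpine λ e → towards-a (trans e (sym x′≡next))
      where
      x′≡next : x′ ≡ next x b
      x′≡next = next-unique xx′ (subst₂ _<_ (dist-sym b x′) (dist-sym b x) (≤-reflexive eb))
      towards-a : next x a ≢ x′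
      towards-a e = <⇒≱ (next-closer x≢a) (subst (λ t → dist x a ≤ dist t a) (sym e)
        (subst₂ _≤_ (dist-sym a x) (dist-sym a x′) (≤-trans (n≤1+n _) (≤-reflexive ea))))
    x′-on : OnSpine x′
    x′-on = begin
      dist a x′ + dist b x′        ≡⟨ cong (_+ dist b x′) (sym ea) ⟩
      suc (dist a x) + dist b x′   ≡⟨ sym (+-suc (dist a x) (dist b x′)) ⟩
      dist a x + suc (dist b x′)   ≡⟨ cong (dist a x +_) eb ⟩
      dist a x + dist b x          ≡⟨ x-on ⟩
      L                            ∎

  move : ∀ {x x′} → AdjOrEq x x′ → Move x x′
  move (inj₂ refl) = level refl
  move (inj₁ xx′) with adj⇒dist-suc a xx′ | adj⇒dist-suc b xx′
  ... | inj₁ ea | inj₁ eb = level (level-step ea eb)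
  ... | inj₂ ea | inj₂ eb = level (sym (level-step ea eb))
  ... | inj₁ ea | inj₂ eb = let (e , on , on′) = up-step xx′ ea eb in up e on on′
  ... | inj₂ ea | inj₁ eb = let (e , on′ , on) = up-step (~-sym G xx′) ea eb in down e on on′

  Move⇒Even : ∀ {x x′} → Move x x′ → Even (β x′) → Even (β x)
  Move⇒Even (level e) (k , p) = k , trans (sym e) p
  Move⇒Even {x} (up e _ _) (zero , p) = ⊥-elim (m+1+n≢0 (β x) (trans (sym e) p))
  Move⇒Even {x} (up e _ _) (suc k , p) = k , +-cancelʳ-≡ 2 (β x) (k + k) (trans (sym e) (trans p (sym (suc+suc k))))
  Move⇒Even (down e _ _) (k , p) = suc k , trans e (trans (cong (_+ 2) p) (suc+suc k))

  β-even : ∀ w → Even (β w)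
  β-even w = towards-a (geodesic w a)
    where
    towards-a : ∀ {u k} → Walk G u a k → Even (β u)
    towards-a (stop _) = 0 , β-a
    towards-a (step _ uu′ W) = Move⇒Even (move (inj₁ uu′)) (towards-a W)

  OnSpine-next : ∀ {w} → OnSpine w → w ≢ a →
                 OnSpine (next w a) × suc (dist a (next w a)) ≡ dist a w × suc (dist w b) ≡ dist (next w a) b
  OnSpine-next {w} on w≢a = p-on , a-step , b-step
    where
    open ≤-Reasoning
    p = next w a
    a-step : suc (dist a p) ≡ dist a w
    a-step = trans (cong suc (dist-sym a p)) (trans (proj₂ (next-spec w≢a)) (dist-sym w a))
    p-on : OnSpine p
    p-on = ≤-antisym (begin
        dist a p + dist b p        ≤⟨ +-monoʳ-≤ (dist a p) (dist-adjʳ-≤ b (next-adj w≢a)) ⟩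
        dist a p + suc (dist b w)  ≡⟨ +-suc (dist a p) (dist b w) ⟩
        suc (dist a p) + dist b w  ≡⟨ cong (_+ dist b w) a-step ⟩
        dist a w + dist b w        ≡⟨ on ⟩
        L                          ∎)
      (subst (λ t → L ≤ dist a p + t) (dist-sym p b) (dist-triangle a p b))
    b-step : suc (dist w b) ≡ dist p b
    b-step = trans (cong suc (dist-sym w b)) (trans
      (+-cancelˡ-≡ (dist a p) (suc (dist b w)) (dist b p) (begin-equality
        dist a p + suc (dist b w)  ≡⟨ +-suc (dist a p) (dist b w) ⟩
        suc (dist a p) + dist b w  ≡⟨ cong (_+ dist b w) a-step ⟩
        dist a w + dist b w        ≡⟨ trans on (sym p-on) ⟩
        dist a p + dist b p        ∎))
      (dist-sym b p))

  OnSpine-unique : ∀ i {w w′} → OnSpine w → OnSpine w′ → dist a w ≡ i → dist a w′ ≡ i → w ≡ w′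
  OnSpine-unique zero _ _ d d′ = trans (sym (dist≡0⇒≡ d)) (dist≡0⇒≡ d′)
  OnSpine-unique (suc i) {w} {w′} on on′ d d′ =
    closer-neighbour-unique (~-sym G (next-adj w≢a)) (subst (λ t → Adj G t w′) (sym same-parent) (~-sym G (next-adj w′≢a)))
      (≤-reflexive b-step) (subst (λ t → dist w′ b < dist t b) (sym same-parent) (≤-reflexive b-step′))
    where
    w≢a : w ≢ a
    w≢a refl = 1+n≢0 (trans (sym d) (dist-refl a))
    w′≢a : w′ ≢ a
    w′≢a refl = 1+n≢0 (trans (sym d′) (dist-refl a))
    parent = OnSpine-next on w≢a
    parent′ = OnSpine-next on′ w′≢a
    b-step = proj₂ (proj₂ parent)
    b-step′ = proj₂ (proj₂ parent′)
    same-parent : next w a ≡ next w′ a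
    same-parent = OnSpine-unique i (proj₁ parent) (proj₁ parent′)
      (suc-injective (trans (proj₁ (proj₂ parent)) d)) (suc-injective (trans (proj₁ (proj₂ parent′)) d′))

  OnSpine-adj : ∀ {x y} → OnSpine x → OnSpine y → dist a y ≡ suc (dist a x) → Adj G x y
  OnSpine-adj {x} {y} x-on y-on d = ~-sym G (subst (Adj G y) parent≡x (next-adj y≢a))
    where
    y≢a : y ≢ a
    y≢a refl = 1+n≢0 (trans (sym d) (dist-refl a))
    parent = OnSpine-next y-on y≢a
    parent≡x : next y a ≡ x
    parent≡x = OnSpine-unique (dist a x) (proj₁ parent) x-on (suc-injective (trans (proj₁ (proj₂ parent)) d)) refl

  OnSpine-β+2⇒adj : ∀ {x y} → OnSpine x → OnSpine y → β y ≡ β x + 2 → Adj G x y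
  OnSpine-β+2⇒adj {x} {y} x-on y-on e = OnSpine-adj x-on y-on (double-injective _ _ (begin
    dist a y + dist a y        ≡⟨ sym (OnSpine⇒β y-on) ⟩
    β y                        ≡⟨ e ⟩
    β x + 2                    ≡⟨ cong (_+ 2) (OnSpine⇒β x-on) ⟩
    dist a x + dist a x + 2    ≡⟨ suc+suc (dist a x) ⟩
    suc (dist a x) + suc (dist a x) ∎))
    where open ≡-Reasoning

  β≡⇒cross : ∀ {o s} → β o ≡ β s → dist o b + dist s a ≡ dist s b + dist o a
  β≡⇒cross {o} {s} e = +-cancelʳ-≡ (β o + L) _ _ (begin
    dist o b + dist s a + (β o + L)  ≡⟨ rearrange (dist o b) (dist s a) (β o) L ⟩
    (β o + dist o b) + (dist s a + L) ≡⟨ cong₂ _+_ (cong (β o +_) (dist-sym o b)) (cong (_+ L) (dist-sym s a)) ⟩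
    (β o + dist b o) + (dist a s + L) ≡⟨ cong₂ _+_ (β-spec o) (sym (trans (cong (_+ dist b s) e) (β-spec s))) ⟩
    (dist a o + L) + (β o + dist b s) ≡⟨ cong₂ _+_ (cong (_+ L) (dist-sym a o)) (cong (β o +_) (dist-sym b s)) ⟩
    (dist o a + L) + (β o + dist s b) ≡⟨ rearrange′ (dist o a) L (β o) (dist s b) ⟩
    dist s b + dist o a + (β o + L)  ∎)
    where
    open ≡-Reasoning
    rearrange : ∀ p q r l → p + q + (r + l) ≡ (r + p) + (q + l)
    rearrange = solve-∀
    rearrange′ : ∀ p l r q → (p + l) + (r + q) ≡ q + p + (r + l)
    rearrange′ = solve-∀

  -- a, b and o lie in different components of G - s, and the diametral choice of a, b
  -- makes both spine legs at least as long as dist s o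
  hanging⇒Triod : ∀ {s o} → OnSpine s → β o ≡ β s → o ≢ s → Triod s (dist s o)
  hanging⇒Triod {s} {o} on eβ o≢s with s F.≟ a | s F.≟ b
  ... | yes refl | _ = ⊥-elim (o≢s (sym (dist≡0⇒≡ (n≤0⇒n≡0 (+-cancelʳ-≤ L (dist a o) 0 (begin
      dist a o + L     ≡⟨ sym (β-spec o) ⟩
      β o + dist b o   ≡⟨ cong (_+ dist b o) (trans eβ β-a) ⟩
      dist b o         ≤⟨ diametral b o ⟩
      L                ∎))))))
    where open ≤-Reasoning
  ... | no _ | yes refl = ⊥-elim (o≢s (sym (dist≡0⇒≡ (n≤0⇒n≡0 (+-cancelˡ-≤ (L + L) (dist b o) 0 (begin
      L + L + dist b o ≡⟨ cong (_+ dist b o) (sym (trans eβ β-b)) ⟩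
      β o + dist b o   ≡⟨ β-spec o ⟩
      dist a o + L     ≤⟨ +-monoˡ-≤ L (diametral a o) ⟩
      L + L            ≡⟨ sym (+-identityʳ (L + L)) ⟩
      L + L + 0        ∎))))))
    where open ≤-Reasoning
  ... | no s≢a | no s≢b =
    a , b , o , (≢-sym s≢a , ≢-sym s≢b , o≢s) , (p≢q , ≢-sym r≢p , ≢-sym r≢q) ,
    within (next≢⇒dist-via r≢q) on′ , within (next≢⇒dist-via r≢p) (trans (+-comm (dist s b) (dist s a)) on′) , ≤-refl
    where
    open ≤-Reasoning
    on′ : dist s a + dist s b ≡ L
    on′ = trans (cong₂ _+_ (dist-sym s a) (dist-sym s b)) on
    p≢q : next s a ≢ next s b
    p≢q e = m+1+n≰m L (begin
      L + 2                ≤⟨ same-next⇒shortcut (≢-sym s≢a) (≢-sym s≢b) e ⟩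
      dist a s + dist s b  ≡⟨ cong (_+ dist s b) (dist-sym a s) ⟩
      dist s a + dist s b  ≡⟨ on′ ⟩
      L                    ∎)
    r≢p : next s o ≢ next s a
    r≢p e = shortcut-cross-absurd (same-next⇒shortcut o≢s (≢-sym s≢a) e)
      (next≢⇒dist-via λ e′ → p≢q (trans (sym e) e′)) (β≡⇒cross eβ)
    r≢q : next s o ≢ next s b
    r≢q e = shortcut-cross-absurd (same-next⇒shortcut o≢s (≢-sym s≢b) e)
      (next≢⇒dist-via r≢p)
      (trans (+-comm (dist o a) (dist s b)) (trans (sym (β≡⇒cross eβ)) (+-comm (dist o b) (dist s a))))
    within : ∀ {x y} → dist o s + dist s y ≤ dist o y → dist s x + dist s y ≡ L → dist s o ≤ dist s x
    within {x} {y} via on-xy = subst (_≤ dist s x) (dist-sym o s) (+-cancelʳ-≤ (dist s y) _ _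
      (≤-trans via (≤-trans (diametral o y) (≤-reflexive (sym on-xy)))))

  far-hanging⇒Triod : ∀ {s o D} → OnSpine s → β o ≡ β s → 0 < D → D ≤ dist s o → Triod s D
  far-hanging⇒Triod on eβ 0<D D≤ = Triod-mono D≤ (hanging⇒Triod on eβ λ { refl → <⇒≱ 0<D (≤-trans D≤ (≤-reflexive (dist-refl _))) })

  module NoTriod (D : ℕ) (2≤D : 2 ≤ D) (no-triod : ∀ v → ¬ Triod v D) where
    level-far-absurd : ∀ {s o} → OnSpine s → β o ≡ β s → D ≤ dist s o → ⊥
    level-far-absurd on eβ D≤ = no-triod _ (far-hanging⇒Triod on eβ (≤-trans (s≤s z≤n) 2≤D) D≤)

    order-preserved : ∀ {x x′ y y′} → AdjOrEq x x′ → AdjOrEq y y′ → D ≤ dist x y → D ≤ dist x′ y′ →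
                      β x < β y → β x′ < β y′
    order-preserved {x} {x′} {y} {y′} xx′ yy′ Dxy Dx′y′ x<y = go (move xx′) (move yy′)
      where
      x+2≤y : β x + 2 ≤ β y
      x+2≤y = even-<⇒+2≤ (β-even x) (β-even y) x<y
      strict-if-x′-on : OnSpine x′ → β x′ ≤ β y′ → β x′ < β y′
      strict-if-x′-on on x′≤y′ = ≤∧≢⇒< x′≤y′ λ e → level-far-absurd on (sym e) Dx′y′
      strict-if-y′-on : OnSpine y′ → β x′ ≤ β y′ → β x′ < β y′
      strict-if-y′-on on x′≤y′ = ≤∧≢⇒< x′≤y′ λ e → level-far-absurd on e (subst (D ≤_) (dist-sym x′ y′) Dx′y′)
      x′<x : β x ≡ β x′ + 2 → β x′ < β x
      x′<x e = subst (β x′ <_) (sym e) (m<m+n (β x′) (s≤s z≤n))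
      go : Move x x′ → Move y y′ → β x′ < β y′
      go (level ex) (level ey) = subst₂ _<_ (sym ex) (sym ey) x<y
      go (level ex) (up ey _ _) = subst₂ _<_ (sym ex) (sym ey) (<-≤-trans x<y (m≤m+n (β y) 2))
      go (level ex) (down ey _ y′-on) =
        strict-if-y′-on y′-on (subst (_≤ β y′) (sym ex) (+-cancelʳ-≤ 2 (β x) (β y′) (subst (β x + 2 ≤_) ey x+2≤y)))
      go (up ex _ x′-on) (level ey) = strict-if-x′-on x′-on (subst₂ _≤_ (sym ex) (sym ey) x+2≤y)
      go (up ex _ _) (up ey _ _) = subst₂ _<_ (sym ex) (sym ey) (+-monoˡ-< 2 x<y)
      go (up ex x-on x′-on) (down ey y-on _)
        with m≤n⇒m<n∨m≡n (+-cancelʳ-≤ 2 (β x) (β y′) (subst (β x + 2 ≤_) ey x+2≤y))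
      ... | inj₁ x<y′ = strict-if-x′-on x′-on (subst (_≤ β y′) (sym ex) (even-<⇒+2≤ (β-even x) (β-even y′) x<y′))
      ... | inj₂ x≡y′ = ⊥-elim (<-irrefl refl (≤-trans 2≤D (≤-trans Dxy (≤-reflexive (adj⇒dist≡1 x~y)))))
        where
        -- the walkers would swap two adjacent spine vertices
        x~y = OnSpine-β+2⇒adj x-on y-on (trans ey (cong (_+ 2) (sym x≡y′)))
      go (down ex _ _) (level ey) = subst₂ _<_ refl (sym ey) (<-trans (x′<x ex) x<y)
      go (down ex _ _) (up ey _ _) = subst₂ _<_ refl (sym ey) (<-trans (<-trans (x′<x ex) x<y) (m<m+n (β y) (s≤s z≤n)))
      go (down ex _ _) (down ey _ _) = +-cancelʳ-< 2 (β x′) (β y′) (subst₂ _<_ ex ey x<y)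

    span<D : ∀ m (f g : Fin (suc m) → V G) → SurjPair G m f g →
             ∀ k → MinDist (PathGraph (suc m)) G f g k → k < D
    span<D m f g (f-hom , g-hom , f-onto , g-onto) k (_ , k-min) = ≰⇒> λ D≤k →
      let far : ∀ t → D ≤ dist (f t) (g t)
          far t = ≤-trans D≤k (k-min t _ (Dist-dist _ _))
          (ta , fta≡a) = f-onto a
          (tb , ftb≡b) = f-onto b
          a-below : β (f ta) < β (g ta)
          a-below = subst (λ t → β t < β (g ta)) (sym fta≡a) (subst (_< β (g ta)) (sym β-a)
            (≤-trans (≤-trans (≤-trans (s≤s z≤n) 2≤D) (subst (λ t → D ≤ dist t (g ta)) fta≡a (far ta))) (dist-a≤β (g ta))))
          b-below : β (f tb) < β (g tb)
          b-below = pathAdj-closed⇒all (λ t → β (f t) < β (g t))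
            (λ u v uv → order-preserved (f-hom u v uv) (g-hom u v uv) (far u) (far v)) ta tb a-below
      in <⇒≱ b-below (subst (λ t → β (g tb) ≤ β t) (sym ftb≡b) (subst (β (g tb) ≤_) (sym β-b) (β≤L+L (g tb))))

  module _ (no-triod : ∀ v → ¬ Triod v 1) where
    private
      σ : Fin (suc L) → V G
      σ = vertexAt (geodesic a b)

      σ-OnSpine : ∀ i → OnSpine (σ i)
      σ-OnSpine i = trans (cong (dist a (σ i) +_) (dist-sym b (σ i))) (shortest-vertexAt-Between (geodesic a b) refl i)

      σ-dist : ∀ i → dist a (σ i) ≡ toℕ i
      σ-dist i = ≤-antisym before (≮⇒≥ λ short → <-irrefl refl (begin-strict
          L                              ≡⟨ sym (σ-OnSpine i) ⟩
          dist a (σ i) + dist b (σ i)    ≡⟨ cong (dist a (σ i) +_) (dist-sym b (σ i)) ⟩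
          dist a (σ i) + dist (σ i) b    <⟨ +-mono-<-≤ short after ⟩
          toℕ i + (L ∸ toℕ i)            ≡⟨ m+[n∸m]≡n (F.toℕ≤pred[n] i) ⟩
          L                              ∎))
        where
        open ≤-Reasoning
        before = dist-minimal (proj₁ (splitAt (geodesic a b) i))
        after = dist-minimal (proj₂ (splitAt (geodesic a b) i))

      σ-injective : ∀ i j → σ i ≡ σ j → i ≡ j
      σ-injective i j e = F.toℕ-injective (trans (sym (σ-dist i)) (trans (cong (dist a) e) (σ-dist j)))

      σ-surjective : ∀ w → Σ (Fin (suc L)) λ i → σ i ≡ w
      σ-surjective w with β-even w
      ... | k , β≡k+k = i , σi≡w
        where
        k<1+L : k < suc L
        k<1+L = s≤s (≮⇒≥ λ L<k → <⇒≱ (+-mono-< L<k L<k) (≤-trans (≤-reflexive (sym β≡k+k)) (β≤L+L w)))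
        i = fromℕ< k<1+L
        β-σi : β w ≡ β (σ i)
        β-σi = trans β≡k+k (sym (trans (OnSpine⇒β (σ-OnSpine i))
                 (cong (λ t → t + t) (trans (σ-dist i) (F.toℕ-fromℕ< k<1+L)))))
        σi≡w : σ i ≡ w
        σi≡w with σ i F.≟ w
        ... | yes e = e
        ... | no ne = ⊥-elim (no-triod (σ i) (far-hanging⇒Triod (σ-OnSpine i) β-σi z<s (≢⇒dist>0 ne)))

      σ-adj : ∀ i j → pathAdj i j ⇔ Adj G (σ i) (σ j)
      σ-adj i j = mk⇔ to from
        where
        to : pathAdj i j → Adj G (σ i) (σ j)
        to (inj₁ e) = OnSpine-adj (σ-OnSpine i) (σ-OnSpine j) (trans (σ-dist j) (trans e (cong suc (sym (σ-dist i)))))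
        to (inj₂ e) = ~-sym G (OnSpine-adj (σ-OnSpine j) (σ-OnSpine i) (trans (σ-dist i) (trans e (cong suc (sym (σ-dist j))))))
        from : Adj G (σ i) (σ j) → pathAdj i j
        from ij with adj⇒dist-suc a ij
        ... | inj₁ e = inj₁ (trans (sym (σ-dist j)) (trans (sym e) (cong suc (σ-dist i))))
        ... | inj₂ e = inj₂ (trans (sym (σ-dist i)) (trans (sym e) (cong suc (σ-dist j))))

    no-triod⇒IsPathGraph : IsPathGraph G
    no-triod⇒IsPathGraph = suc L , σ , σ-injective , σ-surjective , σ-adj

module TriodSize (G : Graph) (conn : Connected G) (acyclic : ¬ HasCycle G) where
  open Walks G
  open Distance G conn
  open Tree G conn acyclic

  InBranch : V G → V G → V G → Set
  InBranch v x w = w ≢ v × next v w ≡ x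

  InBranch? : ∀ v x → U.Decidable (InBranch v x)
  InBranch? v x w = ¬? (w F.≟ v) ×-dec (next v w F.≟ x)

  farthest : V G → V G → V G
  farthest v x = argmax (dist v) v (filter (InBranch? v x) (allFin (n G)))

  reach : V G → V G → ℕ
  reach v x = dist v (farthest v x)

  farthest-InBranch : ∀ v x → farthest v x ≡ v ⊎ InBranch v x (farthest v x)
  farthest-InBranch v x with argmax-sel (dist v) v (filter (InBranch? v x) (allFin (n G)))
  ... | inj₁ e = inj₁ e
  ... | inj₂ m = inj₂ (proj₂ (∈-filter⁻ (InBranch? v x) {xs = allFin (n G)} m))

  InBranch⇒≤reach : ∀ {v x w} → InBranch v x w → dist v w ≤ reach v x
  InBranch⇒≤reach {v} {x} {w} b =
    All.lookup (f[xs]≤f[argmax] {f = dist v} v (filter (InBranch? v x) (allFin (n G))))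
               (∈-filter⁺ (InBranch? v x) (∈-allFin w) b)

  Reach-reach : ∀ {v x} → Adj G v x → Reach G v x (reach v x)
  Reach-reach {v} {x} vx = (farthest v x , attained , Dist-dist v _) , bounded
    where
    x≢v : x ≢ v
    x≢v refl = ~-irr G vx
    attained : SameComp G v x (farthest v x) ⊎ farthest v x ≡ v
    attained with farthest-InBranch v x
    ... | inj₁ e = inj₂ e
    ... | inj₂ (w≢v , e) = inj₁ (same-next⇒SameComp x≢v w≢v (trans (next-of-neighbour vx) (sym e)))
    bounded : ∀ w j → SameComp G v x w ⊎ w ≡ v → Dist G v w j → j ≤ reach v x
    bounded w j (inj₂ refl) d = subst (_≤ reach v x) (sym (trans (Dist⇒≡dist d) (dist-refl v))) z≤n
    bounded w j (inj₁ (_ , W)) d = subst (_≤ reach v x) (sym (Dist⇒≡dist d))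
      (InBranch⇒≤reach (end-holds W , trans (sym (avoiding⇒same-next W)) (next-of-neighbour vx)))

  module AtVertex (v : V G) where
    by-reach : DecTotalOrder _ _ _
    by-reach = On.decTotalOrder (Flip.decTotalOrder ≤-decTotalOrder) (reach v)

    open Sort by-reach using (sort; sort-↭; sort-↗)

    neighbours : List (V G)
    neighbours = filter (~-dec G v) (allFin (n G))

    sorted : List (V G)
    sorted = sort neighbours

    deg≡length : deg G v ≡ length sorted
    deg≡length = sym (↭-length (sort-↭ neighbours))

    neighbour : Fin (deg G v) → V G
    neighbour i = lookup sorted (cast deg≡length i)

    neighbour-adj : ∀ i → Adj G v (neighbour i)
    neighbour-adj i = proj₂ (∈-filter⁻ (~-dec G v) {xs = allFin (n G)}
      (∈-resp-↭ (sort-↭ neighbours) (∈-lookup (cast deg≡length i))))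

    neighbour-≢ : ∀ i → neighbour i ≢ v
    neighbour-≢ i e = ~-irr G (subst (Adj G v) e (neighbour-adj i))

    neighbour-injective : ∀ i j → neighbour i ≡ neighbour j → i ≡ j
    neighbour-injective i j e = cast-injective deg≡length i j (Unique-lookup-injective unique _ _ e)
      where
      unique : Unique sorted
      unique = PermutationSetoid.Unique-resp-↭ (setoid (V G)) (↭⇒↭ₛ (↭-sym (sort-↭ neighbours)))
                 (Unique.filter⁺ (~-dec G v) (Unique.allFin⁺ (n G)))

    neighbour-surjective : ∀ {x} → Adj G v x → Σ (Fin (deg G v)) λ i → neighbour i ≡ x
    neighbour-surjective {x} vx = cast (sym deg≡length) (Any.index x∈) ,
      trans (cong (lookup sorted) (F.cast-involutive deg≡length (sym deg≡length) (Any.index x∈))) (sym (lookup-index x∈))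
      where
      x∈ : x ∈ sorted
      x∈ = ∈-resp-↭ (↭-sym (sort-↭ neighbours)) (∈-filter⁺ (~-dec G v) (∈-allFin x) vx)

    neighbour-sorted : ∀ i j → toℕ i ≤ toℕ j → reach v (neighbour j) ≤ reach v (neighbour i)
    neighbour-sorted i j i≤j = lookup-mono-≤ (DecTotalOrder.totalOrder by-reach) (sort-↗ neighbours)
      (subst₂ _≤_ (sym (F.toℕ-cast deg≡length i)) (sym (F.toℕ-cast deg≡length j)) i≤j)

    η : ℕ
    η with 2 <? deg G v
    ... | yes 2<d = reach v (neighbour (fromℕ< 2<d))
    ... | no _ = 0

    TriodAt-η : TriodAt G v η
    TriodAt-η with 2 <? deg G v
    ... | no 2≮d = inj₁ (≮⇒≥ 2≮d , refl)
    ... | yes 2<d = inj₂ (2<d , neighbour , reach v ∘ neighbour , neighbour-≢ , distinct , exhaustive ,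
                          Reach-reach ∘ neighbour-adj , neighbour-sorted , refl)
      where
      distinct : ∀ i j → SameComp G v (neighbour i) (neighbour j) → i ≡ j
      distinct i j (_ , W) = neighbour-injective i j
        (trans (sym (next-of-neighbour (neighbour-adj i))) (trans (avoiding⇒same-next W) (next-of-neighbour (neighbour-adj j))))
      exhaustive : ∀ u → u ≢ v → ∃ λ i → SameComp G v (neighbour i) u
      exhaustive u u≢v = let (i , e) = neighbour-surjective (next-adj (≢-sym u≢v)) in
        i , same-next⇒SameComp (neighbour-≢ i) u≢v (trans (next-of-neighbour (neighbour-adj i)) e)

    Triod⇒≤η : ∀ {D} → Triod v D → D ≤ η
    Triod⇒≤η {D} (w₁ , w₂ , w₃ , (w₁≢v , w₂≢v , w₃≢v) , (d₁₂ , d₁₃ , d₂₃) , (D₁ , D₂ , D₃)) = bound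
      where
      index : ∀ {w} → w ≢ v → Σ (Fin (deg G v)) λ i → neighbour i ≡ next v w
      index w≢v = neighbour-surjective (next-adj (≢-sym w≢v))
      reach≥ : ∀ {w} (w≢v : w ≢ v) → D ≤ dist v w → D ≤ reach v (neighbour (proj₁ (index w≢v)))
      reach≥ {w} w≢v D≤ = ≤-trans D≤ (InBranch⇒≤reach (w≢v , sym (proj₂ (index w≢v))))
      index-≢ : ∀ {w w′} (w≢v : w ≢ v) (w′≢v : w′ ≢ v) → next v w ≢ next v w′ → proj₁ (index w≢v) ≢ proj₁ (index w′≢v)
      index-≢ w≢v w′≢v ne e = ne (trans (sym (proj₂ (index w≢v))) (trans (cong neighbour e) (proj₂ (index w′≢v))))
      late : Σ (Fin (deg G v)) λ i → 2 ≤ toℕ i × D ≤ reach v (neighbour i)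
      late = [ (λ h → _ , h , reach≥ w₁≢v D₁) , [ (λ h → _ , h , reach≥ w₂≢v D₂) , (λ h → _ , h , reach≥ w₃≢v D₃) ]′ ]′
        (distinct-three⇒2≤ (proj₁ (index w₁≢v)) (proj₁ (index w₂≢v)) (proj₁ (index w₃≢v))
          (index-≢ w₁≢v w₂≢v d₁₂) (index-≢ w₁≢v w₃≢v d₁₃) (index-≢ w₂≢v w₃≢v d₂₃))
      i = proj₁ late
      2≤i = proj₁ (proj₂ late)
      bound : D ≤ η
      bound with 2 <? deg G v
      ... | yes 2<d = ≤-trans (proj₂ (proj₂ late)) (neighbour-sorted (fromℕ< 2<d) i (subst (_≤ toℕ i) (sym (F.toℕ-fromℕ< 2<d)) 2≤i))
      ... | no 2≮d = ⊥-elim (2≮d (≤-<-trans 2≤i (F.toℕ<n i)))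

    TriodAt⇒≤η : ∀ {e} → TriodAt G v e → e ≤ η
    TriodAt⇒≤η {zero} _ = z≤n
    TriodAt⇒≤η {suc e} t = Triod⇒≤η (TriodAt⇒Triod t z<s)

module LowerBound (G : Graph) (conn : Connected G) (acyclic : ¬ HasCycle G) (v₀ : V G) (H : ℕ) where
  open Walks G
  open Distance G conn
  open Tree G conn acyclic

  Away : V G → V G → Set
  Away c u = u ≡ v₀ ⊎ (u ≢ v₀ × next v₀ u ≢ next v₀ c)

  Away? : ∀ c → U.Decidable (Away c)
  Away? c u = (u F.≟ v₀) ⊎-dec (¬? (u F.≟ v₀) ×-dec ¬? (next v₀ u F.≟ next v₀ c))

  Away⇒far : ∀ {c u} → H ≤ dist v₀ c → Away c u → H ≤ dist u c
  Away⇒far H≤ (inj₁ refl) = H≤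
  Away⇒far {c} {u} H≤ (inj₂ (_ , ne)) = ≤-trans H≤ (≤-trans (m≤n+m (dist v₀ c) (dist u v₀)) (next≢⇒dist-via ne))

  Away-Between : ∀ {c p u} → Away c p → Between v₀ p u → Away c u
  Away-Between {c} {p} {u} away b with u F.≟ v₀ | away
  ... | yes u≡v₀ | _ = inj₁ u≡v₀
  ... | no u≢v₀ | inj₁ refl = ⊥-elim (u≢v₀ (sym (dist≡0⇒≡ (m+n≡0⇒m≡0 (dist v₀ u) (trans b (dist-refl v₀))))))
  ... | no u≢v₀ | inj₂ (_ , ne) = inj₂ (u≢v₀ , λ e → ne (trans (sym (Between⇒same-next u≢v₀ b)) e))

  route : ∀ {c p z} → Away c p → Away c z → Σ ℕ (WalkIn G (Away c) p z)
  route ap az = _ , reverseʷ (mapʷ (Away-Between ap) (geodesicBetween v₀ _)) ++ʷ mapʷ (Away-Between az) (geodesicBetween v₀ _)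

  Far : V G × V G → Set
  Far (x , y) = H ≤ dist x y

  Far-swap : ∀ {s} → Far s → Far (swap s)
  Far-swap {x , y} = subst (H ≤_) (dist-sym x y)

  Step : V G × V G → V G × V G → Set
  Step (x , y) (x′ , y′) = AdjOrEq x x′ × AdjOrEq y y′

  data JointWalk : V G × V G → V G × V G → ℕ → Set where
    rest    : ∀ {s} → Far s → JointWalk s s 0
    advance : ∀ {s s′ e k} → Far s → Step s s′ → JointWalk s′ e k → JointWalk s e (suc k)

  infixr 5 _++ʲ_
  _++ʲ_ : ∀ {s m e k l} → JointWalk s m k → JointWalk m e l → JointWalk s e (k + l)
  rest _ ++ʲ W = W
  advance f st W ++ʲ W′ = advance f st (W ++ʲ W′)

  swapʲ : ∀ {s e k} → JointWalk s e k → JointWalk (swap s) (swap e) k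
  swapʲ (rest f) = rest (Far-swap f)
  swapʲ (advance f (sx , sy) W) = advance (Far-swap f) (sy , sx) (swapʲ W)

  Visits : (V G × V G → V G) → ∀ {s e k} → JointWalk s e k → V G → Set
  Visits π (rest {s} _) z = π s ≡ z
  Visits π (advance {s} _ _ W) z = π s ≡ z ⊎ Visits π W z

  module _ {π : V G × V G → V G} where
    visits-++ˡ : ∀ {s m e k l z} (W : JointWalk s m k) (W′ : JointWalk m e l) → Visits π W z → Visits π (W ++ʲ W′) z
    visits-++ˡ (rest _) (rest _) v = v
    visits-++ˡ (rest _) (advance _ _ _) v = inj₁ v
    visits-++ˡ (advance _ _ W) W′ (inj₁ v) = inj₁ v
    visits-++ˡ (advance _ _ W) W′ (inj₂ v) = inj₂ (visits-++ˡ W W′ v)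

    visits-++ʳ : ∀ {s m e k l z} (W : JointWalk s m k) (W′ : JointWalk m e l) → Visits π W′ z → Visits π (W ++ʲ W′) z
    visits-++ʳ (rest _) W′ v = v
    visits-++ʳ (advance _ _ W) W′ v = inj₂ (visits-++ʳ W W′ v)

    visits-end : ∀ {s e k} (W : JointWalk s e k) → Visits π W (π e)
    visits-end (rest _) = refl
    visits-end (advance _ _ W) = inj₂ (visits-end W)

  visits-swap : ∀ {s e k z} (W : JointWalk s e k) → Visits proj₁ W z → Visits proj₂ (swapʲ W) z
  visits-swap (rest _) v = v
  visits-swap (advance _ _ W) (inj₁ v) = inj₁ v
  visits-swap (advance _ _ W) (inj₂ v) = inj₂ (visits-swap W v)

  position : ∀ {s e k} → JointWalk s e k → Fin (suc k) → V G × V G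
  position {s} W fzero = s
  position (advance _ _ W) (fsuc i) = position W i

  position-far : ∀ {s e k} (W : JointWalk s e k) i → Far (position W i)
  position-far (rest f) fzero = f
  position-far (advance f _ _) fzero = f
  position-far (advance _ _ W) (fsuc i) = position-far W i

  position-step : ∀ {s e k} (W : JointWalk s e k) (i : Fin k) → Step (position W (inject₁ i)) (position W (fsuc i))
  position-step (advance _ st _) fzero = st
  position-step (advance _ _ W) (fsuc i) = position-step W i

  Visits⇒position : ∀ {π s e k z} (W : JointWalk s e k) → Visits π W z → Σ (Fin (suc k)) λ i → π (position W i) ≡ z
  Visits⇒position (rest _) v = fzero , v
  Visits⇒position (advance _ _ W) (inj₁ v) = fzero , v
  Visits⇒position (advance _ _ W) (inj₂ v) = let (i , e) = Visits⇒position W v in fsuc i , e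

  module Parked (c : V G) (H≤ : H ≤ dist v₀ c) where
    far : ∀ {u} → Away c u → Far (u , c)
    far = Away⇒far H≤

    move-first : ∀ {p p′ k} → WalkIn G (Away c) p p′ k → JointWalk (p , c) (p′ , c) k
    move-first (stop a) = rest (far a)
    move-first (step a pp′ W) = advance (far a) (inj₁ pp′ , inj₂ refl) (move-first W)

    shift : ∀ {p p′} → Away c p → Away c p′ → Σ ℕ λ k → JointWalk (p , c) (p′ , c) k
    shift ap ap′ = let (k , W) = route ap ap′ in k , move-first W

    tour : ∀ {p} → Away c p → (zs : List (V G)) →
           Σ ℕ λ k → Σ (JointWalk (p , c) (p , c) k) λ W → ∀ z → z ∈ zs → Away c z → Visits proj₁ W z
    tour ap [] = 0 , rest (far ap) , λ _ ()
    tour ap (z ∷ zs) with Away? c z | tour ap zs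
    ... | no ¬az | k , W , covers = k , W , covers′
      where
      covers′ : ∀ z′ → z′ ∈ z ∷ zs → Away c z′ → Visits proj₁ W z′
      covers′ _ (here refl) az = ⊥-elim (¬az az)
      covers′ z′ (there m) az′ = covers z′ m az′
    ... | yes az | k , W , covers = _ , (out ++ʲ back) ++ʲ W , covers′
      where
      out = proj₂ (shift ap az)
      back = proj₂ (shift az ap)
      covers′ : ∀ z′ → z′ ∈ z ∷ zs → Away c z′ → Visits proj₁ ((out ++ʲ back) ++ʲ W) z′
      covers′ _ (here refl) _ = visits-++ˡ (out ++ʲ back) W (visits-++ˡ out back (visits-end out))
      covers′ z′ (there m) az′ = visits-++ʳ (out ++ʲ back) W (covers z′ m az′)

    covering-tour : ∀ {p} → Away c p → Σ ℕ λ k → Σ (JointWalk (p , c) (p , c) k) λ W → ∀ z → Away c z → Visits proj₁ W z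
    covering-tour ap = let (k , W , covers) = tour ap (allFin (n G)) in k , W , λ z → covers z (∈-allFin z)

  Away-cover : ∀ {c c′} → next v₀ c ≢ next v₀ c′ → ∀ z → Away c z ⊎ Away c′ z
  Away-cover {c} {c′} ne z with z F.≟ v₀
  ... | yes e = inj₁ (inj₁ e)
  ... | no z≢v₀ with next v₀ z F.≟ next v₀ c
  ...   | yes e = inj₂ (inj₂ (z≢v₀ , λ e′ → ne (trans (sym e) e′)))
  ...   | no ne′ = inj₁ (inj₂ (z≢v₀ , ne′))

  -- While one walker is parked on a leg, the other may roam outside that leg's component, staying H away.
  -- f tours outside the components of w₂ and then of w₃, g those of w₁ and then of w₂.
  Triod⇒far-pair : Triod v₀ H → Σ ℕ λ m → Σ (Fin (suc m) → V G) λ f → Σ (Fin (suc m) → V G) λ g →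
                   SurjPair G m f g × (∀ t → H ≤ dist (f t) (g t))
  Triod⇒far-pair (w₁ , w₂ , w₃ , (w₁≢v₀ , w₂≢v₀ , w₃≢v₀) , (d₁₂ , d₁₃ , d₂₃) , (H₁ , H₂ , H₃)) =
    _ , f , g , (f-hom , g-hom , f-onto , g-onto) , position-far W
    where
    module P₁ = Parked w₁ H₁
    module P₂ = Parked w₂ H₂
    module P₃ = Parked w₃ H₃
    tour₁ = P₂.covering-tour {w₁} (inj₂ (w₁≢v₀ , d₁₂))
    tour₂ = P₃.covering-tour {w₁} (inj₂ (w₁≢v₀ , d₁₃))
    tour₃ = P₁.covering-tour {w₃} (inj₂ (w₃≢v₀ , ≢-sym d₁₃))
    tour₄ = P₂.covering-tour {w₃} (inj₂ (w₃≢v₀ , ≢-sym d₂₃))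
    T₁ = proj₁ (proj₂ tour₁)
    S₂ = swapʲ (proj₂ (P₁.shift (inj₂ (w₂≢v₀ , ≢-sym d₁₂)) (inj₂ (w₃≢v₀ , ≢-sym d₁₃))))
    T₃ = proj₁ (proj₂ tour₂)
    T₄ = swapʲ (proj₁ (proj₂ tour₃))
    S₅ = proj₂ (P₃.shift (inj₂ (w₁≢v₀ , d₁₃)) (inj₂ (w₂≢v₀ , d₂₃)))
    T₆ = swapʲ (proj₁ (proj₂ tour₄))
    W₅ = S₅ ++ʲ T₆
    W₄ = T₄ ++ʲ W₅
    W₃ = T₃ ++ʲ W₄
    W₂ = S₂ ++ʲ W₃
    W = T₁ ++ʲ W₂
    f g : Fin _ → V G
    f = proj₁ ∘ position W
    g = proj₂ ∘ position W
    f-hom : WeakHom (PathGraph _) G f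
    f-hom = consecutive⇒WeakHom {G} f (proj₁ ∘ position-step W)
    g-hom : WeakHom (PathGraph _) G g
    g-hom = consecutive⇒WeakHom {G} g (proj₂ ∘ position-step W)
    f-visits : ∀ z → Visits proj₁ W z
    f-visits z with Away-cover d₂₃ z
    ... | inj₁ a = visits-++ˡ T₁ W₂ (proj₂ (proj₂ tour₁) z a)
    ... | inj₂ a = visits-++ʳ T₁ W₂ (visits-++ʳ S₂ W₃ (visits-++ˡ T₃ W₄ (proj₂ (proj₂ tour₂) z a)))
    g-visits : ∀ z → Visits proj₂ W z
    g-visits z with Away-cover d₁₂ z
    ... | inj₁ a = visits-++ʳ T₁ W₂ (visits-++ʳ S₂ W₃ (visits-++ʳ T₃ W₄ (visits-++ˡ T₄ W₅
                     (visits-swap (proj₁ (proj₂ tour₃)) (proj₂ (proj₂ tour₃) z a)))))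
    ... | inj₂ a = visits-++ʳ T₁ W₂ (visits-++ʳ S₂ W₃ (visits-++ʳ T₃ W₄ (visits-++ʳ T₄ W₅ (visits-++ʳ S₅ T₆
                     (visits-swap (proj₁ (proj₂ tour₄)) (proj₂ (proj₂ tour₄) z a))))))
    f-onto : Surj f
    f-onto z = Visits⇒position W (f-visits z)
    g-onto : Surj g
    g-onto z = Visits⇒position W (g-visits z)

IsSVS-trivial : ∀ (T : Graph) → n T ≡ 1 → IsSVS T 0
IsSVS-trivial T n≡1 = (0 , const , const , (stay , stay , onto , onto) , min-dist) , λ _ f g _ _ (_ , k-min) →
  k-min fzero 0 (subst (λ z → Dist T (f fzero) z 0) (all-equal _ _) (stop tt , λ _ _ → z≤n))
  where
  all-equal : ∀ (x y : V T) → x ≡ y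
  all-equal = subst (λ k → (x y : Fin k) → x ≡ y) (sym n≡1) λ { fzero fzero → refl }
  const : Fin 1 → V T
  const _ = subst Fin (sym n≡1) fzero
  stay : WeakHom (PathGraph 1) T const
  stay _ _ _ = inj₂ refl
  onto : Surj const
  onto y = fzero , all-equal _ y
  min-dist : MinDist (PathGraph 1) T const const 0
  min-dist = (fzero , stop tt , λ _ _ → z≤n) , λ _ _ _ → z≤n

module TreeSpan (T : Graph) (n≥1 : 1 ≤ n T) (conn : Connected T) (acyclic : ¬ HasCycle T) where
  open Distance T conn
  open Tree T conn acyclic
  open TriodSize T conn acyclic

  some-vertex : V T
  some-vertex = fromℕ< n≥1

  farthest-from : V T → V T
  farthest-from u = maximiser (dist u) u

  a b : V T
  a = maximiser (λ u → dist u (farthest-from u)) some-vertex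
  b = farthest-from a

  diametral : ∀ u w → dist u w ≤ dist a b
  diametral u w = ≤-trans (≤-maximiser (dist u) u w) (≤-maximiser (λ u → dist u (farthest-from u)) some-vertex u)

  open Spine T conn acyclic a b diametral

  IsSVS-intro : ∀ h → 0 < h → (∀ v → ¬ Triod v (suc h)) →
                (Σ ℕ λ m → Σ (Fin (suc m) → V T) λ f → Σ (Fin (suc m) → V T) λ g →
                  SurjPair T m f g × (∀ t → h ≤ dist (f t) (g t))) → IsSVS T h
  IsSVS-intro h 0<h no-triod (m , f , g , pair , far) =
    (m , f , g , pair , subst (MinDist (PathGraph (suc m)) T f g) k≡h min-dist) , upper
    where
    open NoTriod (suc h) (s≤s 0<h) no-triod
    upper : ∀ m (f g : Fin (suc m) → V T) → SurjPair T m f g → ∀ k → MinDist (PathGraph (suc m)) T f g k → k ≤ h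
    upper m f g pair k md = ≤-pred (span<D m f g pair k md)
    gap : Fin (suc m) → ℕ
    gap t = dist (f t) (g t)
    t* = minimiser gap fzero
    min-dist : MinDist (PathGraph (suc m)) T f g (gap t*)
    min-dist = (t* , Dist-dist _ _) , λ u j d → subst (gap t* ≤_) (sym (Dist⇒≡dist d)) (minimiser-≤ gap fzero u)
    k≡h : gap t* ≡ h
    k≡h = ≤-antisym (upper m f g pair _ min-dist) (far t*)

  IsSVS-path : IsPathGraph T → 2 ≤ n T → IsSVS T 1
  IsSVS-path path@(N , σ , _ , onto , adj) 2≤n = from-path σ onto adj (≤-trans 2≤n (Surj⇒≥ onto))
    where
    from-path : ∀ {N} (σ : Fin N → V T) → Surj σ → (∀ i j → pathAdj i j ⇔ Adj T (σ i) (σ j)) → 2 ≤ N → IsSVS T 1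
    from-path {suc (suc k)} σ onto adj _ = IsSVS-intro 1 z<s (λ v → IsPathGraph⇒no-Triod path v 2)
      (2 + k , _ , _ , proj₁ pair , λ t → ≤-reflexive (sym (adj⇒dist≡1 (proj₂ pair t))))
      where
      pair = adjacent-pair-on-path {T} σ onto (λ i j → Equivalence.to (adj i j))
    from-path {suc zero} _ _ _ (s≤s ())

  η : V T → ℕ
  η = AtVertex.η

  v₀ : V T
  v₀ = maximiser η some-vertex

  H : ℕ
  H = η v₀

  TriodSize-H : TriodSize T H
  TriodSize-H = (v₀ , AtVertex.TriodAt-η v₀) ,
    λ v e t → ≤-trans (AtVertex.TriodAt⇒≤η v t) (≤-maximiser η some-vertex v)

  no-Triod-above-H : ∀ v → ¬ Triod v (suc H)
  no-Triod-above-H v t = <⇒≱ (s≤s (≤-maximiser η some-vertex v)) (AtVertex.Triod⇒≤η v t)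

  ¬IsPathGraph⇒H>0 : ¬ IsPathGraph T → 0 < H
  ¬IsPathGraph⇒H>0 not-path = n≢0⇒n>0 λ H≡0 →
    not-path (no-triod⇒IsPathGraph λ v t → no-Triod-above-H v (subst (Triod v) (cong suc (sym H≡0)) t))

  IsSVS-triod : ¬ IsPathGraph T → Σ ℕ λ h → TriodSize T h × IsSVS T h
  IsSVS-triod not-path = H , TriodSize-H , IsSVS-intro H 0<H no-Triod-above-H
    (LowerBound.Triod⇒far-pair T conn acyclic v₀ H (TriodAt⇒Triod (AtVertex.TriodAt-η v₀) 0<H))
    where
    0<H = ¬IsPathGraph⇒H>0 not-path

corollary2p5 : (T : Graph) → IsTree T →
    (n T ≡ 1 → IsSVS T 0) ×
    (IsPathGraph T → 2 ≤ n T → IsSVS T 1) ×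
    (¬ IsPathGraph T → Σ ℕ λ h → TriodSize T h × IsSVS T h)
corollary2p5 T (n≥1 , conn , acyclic) = IsSVS-trivial T , IsSVS-path , IsSVS-triod
  where open TreeSpan T n≥1 conn acyclic
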